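{- Suppose $a=a_1\dots a_r$ and $b=b_1\dots b_s$ are binary sequences, and define \[ c= \begin{cases} a|b&\text{if $a_r=b_1$}\\ a|\bar b&\text{if $a_r\neq b_1$}. \end{cases} \] Then $\mathcal{P}_a\mathbin{\square}\mathcal{P}_b\cong\mathcal{P}_c$.
   Context: For a binary sequence $a=a_1\dots a_n$, $\bar a$ swaps $0$ and $1$ in every entry, and $a|b$ denotes concatenation. Define $a(0)=1a_1\dots a_n$, $a(i)=a_1\dots a_{i-1}\,0\,1\,a_{i+1}\dots a_n$ ($1\leq i\leq n$), $a(n+1)=a_1\dots a_n0$. Sequences $b,c$ of equal length are opposed if $b_i>c_i$ and $b_j<c_j$ for some $i,j$. $\mathcal{P}_a=\{a(0),\dots,a(n+1)\}$ with partial order $a(i)\prec a(j)$ iff $i<j$ and $a(i),a(j)$ opposed; $\mathcal{P}_a$ is a $2$-chain (a finite poset uniquely expressible as a union of two chains, with order maximal with this property), and $\mathcal{P}_a\cong\mathcal{P}_{\bar a}$. A maximal element is supermaximal if it lies above all non-maximal elements; superminimal dually. Splice: if $P$ has exactly two maximal elements $p_0,p_1$ with only $p_0$ supermaximal, and $Q$ has exactly two minimal elements $q_0,q_1$ with only $q_0$ superminimal, $P\mathbin{\square}Q$ is obtained from $P\sqcup Q$ (orders within $P$, $Q$ unchanged; for $x\in P$, $y\in Q$: $x\preceq y$ iff $x\preceq p_i$ and $q_i\preceq y$ for some $i$; no element of $Q$ below an element of $P$) by identifying $p_0$ with $q_0$ and $p_1$ with $q_1$. For $\mathcal{P}_\varnothing$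 (two incomparable elements), $P\mathbin{\square}\mathcal{P}_\varnothing=P$ and $\mathcal{P}_\varnothing\mathbin{\square}Q=Q$. -}

module Defs where

open import Data.Bool using (Bool; true; false; not; if_then_else_; _∧_)
open import Data.Bool.Properties using () renaming (_≟_ to _≟ᵇ_)
open import Data.Nat using (ℕ; zero; suc; _+_; _<_)
open import Data.Fin using (Fin; toℕ)
open import Data.List using (List; []; _∷_; _++_; [_]; length; map; zip)
open import Data.List.Relation.Unary.Any using (Any)
open import Data.Product using (Σ; Σ-syntax; _×_; _,_)
open import Data.Sum using (_⊎_)
open import Relation.Nullary using (¬_; does)
open import Relation.Binary.PropositionalEquality using (_≡_; _≢_)
open import Function.Bundles using (_⇔_)

-- Binary sequences are lists of Booleans (true = 1, false = 0).

compl : List Bool → List Bool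
compl = map not

-- a(i) for a = a₁…aₙ and 0 ≤ i ≤ n+1 (as in the paper):
--   a(0) = 1 a₁ … aₙ,  a(i) = a₁…a_{i-1} 0 1 a_{i+1}…aₙ,  a(n+1) = a₁…aₙ 0
ext : List Bool → ℕ → List Bool
ext a zero = true ∷ a
ext [] (suc _) = false ∷ []
ext (x ∷ a) (suc zero) = false ∷ true ∷ a
ext (x ∷ a) (suc (suc i)) = x ∷ ext a (suc i)

Opposed : List Bool → List Bool → Set
Opposed b c = Any (λ p → Data.Product.proj₁ p ≡ true × Data.Product.proj₂ p ≡ false) (zip b c)
            × Any (λ p → Data.Product.proj₁ p ≡ false × Data.Product.proj₂ p ≡ true) (zip b c)

-- A finite poset presented on Fin size by its (reflexive) order relation.
record FinPoset : Set₁ where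
  field
    size : ℕ
    _≼_ : Fin size → Fin size → Set
open FinPoset public

𝒫 : List Bool → FinPoset
𝒫 a = record
  { size = length a + 2
  ; _≼_ = λ i j → i ≡ j ⊎ (toℕ i < toℕ j × Opposed (ext a (toℕ i)) (ext a (toℕ j)))
  }

module _ (P : FinPoset) where
  private
    _≤_ = _≼_ P
  Maximal : Fin (size P) → Set
  Maximal x = ∀ y → x ≤ y → y ≡ x

  Minimal : Fin (size P) → Set
  Minimal x = ∀ y → y ≤ x → y ≡ x

  Supermaximal : Fin (size P) → Set
  Supermaximal x = Maximal x × (∀ y → ¬ Maximal y → y ≤ x)

  Superminimal : Fin (size P) → Set
  Superminimal x = Minimal x × (∀ y → ¬ Minimal y → x ≤ y)

  SpliceLeft : Fin (size P) → Fin (size P) → Set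
  SpliceLeft p₀ p₁ = p₀ ≢ p₁ × Maximal p₀ × Maximal p₁
                   × (∀ x → Maximal x → x ≡ p₀ ⊎ x ≡ p₁)
                   × Supermaximal p₀ × ¬ Supermaximal p₁

  SpliceRight : Fin (size P) → Fin (size P) → Set
  SpliceRight q₀ q₁ = q₀ ≢ q₁ × Minimal q₀ × Minimal q₁
                    × (∀ x → Minimal x → x ≡ q₀ ⊎ x ≡ q₁)
                    × Superminimal q₀ × ¬ Superminimal q₁

-- The splice P □ Q is presented on the disjoint union Fin |P| ⊎ Fin |Q|
-- modulo the identification p₀ ~ q₀, p₁ ~ q₁.
module Splice (P Q : FinPoset) (p₀ p₁ : Fin (size P)) (q₀ q₁ : Fin (size Q)) where
  Carrier : Set
  Carrier = Fin (size P) ⊎ Fin (size Q)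

  SLe : Carrier → Carrier → Set
  SLe (Data.Sum.inj₁ x) (Data.Sum.inj₁ y) = _≼_ P x y
  SLe (Data.Sum.inj₂ x) (Data.Sum.inj₂ y) = _≼_ Q x y
  SLe (Data.Sum.inj₁ x) (Data.Sum.inj₂ y) =
    (_≼_ P x p₀ × _≼_ Q q₀ y) ⊎ (_≼_ P x p₁ × _≼_ Q q₁ y)
  SLe (Data.Sum.inj₂ x) (Data.Sum.inj₁ y) = Data.Empty.⊥
    where import Data.Empty

  Ident : Carrier → Carrier → Set
  Ident u v = u ≡ v
    ⊎ (u ≡ Data.Sum.inj₁ p₀ × v ≡ Data.Sum.inj₂ q₀)
    ⊎ (u ≡ Data.Sum.inj₂ q₀ × v ≡ Data.Sum.inj₁ p₀)
    ⊎ (u ≡ Data.Sum.inj₁ p₁ × v ≡ Data.Sum.inj₂ q₁)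
    ⊎ (u ≡ Data.Sum.inj₂ q₁ × v ≡ Data.Sum.inj₁ p₁)

  QLe : Carrier → Carrier → Set
  QLe u v = Σ[ u′ ∈ Carrier ] Σ[ v′ ∈ Carrier ] Ident u u′ × Ident v v′ × SLe u′ v′

  -- P □ Q ≅ R : a surjection f from P ⊔ Q onto R whose fibres are exactly
  -- the identification classes (so it induces a bijection from P □ Q),
  -- and which preserves and reflects the order.
  IsoTo : (R : FinPoset) → Set
  IsoTo R = Σ[ f ∈ (Carrier → Fin (size R)) ]
      (∀ z → Σ[ u ∈ Carrier ] f u ≡ z)
    × (∀ u v → (f u ≡ f v) ⇔ Ident u v)
    × (∀ u v → _≼_ R (f u) (f v) ⇔ QLe u v)

glue : List Bool → Bool → Bool → List Bool → List Bool
glue a aᵣ b₁ b = if does (aᵣ ≟ᵇ b₁) then a ++ b else a ++ compl b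

-- 𝒫_a is an interval order.  Read a as the word 0 a₁ … aᵣ 1 and represent a(t) by the
-- interval running from a 1 at position t back to the previous 1, or from a 0 at t forward to
-- the next 0; then a(i) ≺ a(j) exactly when the interval of i ends where or before that of j
-- starts.  For c = a|b with aᵣ = b₁ the pictures of 𝒫_a and 𝒫_b lie side by side in that of
-- 𝒫_c: only the two maximal elements of 𝒫_a (the last 0 of a and the final sentinel) reach
-- past position r, only those of the two minimal elements of 𝒫_b (the initial sentinel and
-- the first 1 of b) start by it, and these pairs merge into two intervals of 𝒫_c, which is
-- the splice.  When aᵣ ≠ b₁, b is first replaced by b̄, using 𝒫_b ≅ 𝒫_b̄.

module Submission where

open import Defs
open import Data.Bool using (Bool; true; false; not; if_then_else_; _∧_; _∨_; T)
open import Data.Bool.Properties using (∧-inverseʳ; not-involutive) renaming (_≟_ to _≟ᵇ_)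
open import Data.Unit using (tt)
open import Data.Nat using (ℕ; zero; suc; _+_; _∸_; _<_; _≤_; z≤n; s≤s; _≤?_; _≤ᵇ_)
open import Data.Nat.Properties hiding (_≟_)
open import Data.Fin using (Fin; toℕ; fromℕ<; _≟_)
open import Data.Fin.Properties using (toℕ<n; toℕ-fromℕ<; toℕ-injective)
open import Data.List using (List; []; _∷_; _++_; [_]; length; zip)
open import Data.List.Properties using (length-map; length-++)
open import Data.List.Relation.Unary.Any using (Any; here; there)
open import Data.Sum using (_⊎_; inj₁; inj₂)
import Data.Sum as Sum
open import Data.Product using (Σ-syntax; _×_; _,_; proj₁; proj₂)
import Data.Product as Product
open import Data.Empty using (⊥-elim)
open import Relation.Nullary using (¬_; yes; no; does)
open import Relation.Binary.Definitions using (tri<; tri≈; tri>)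
open import Relation.Binary.PropositionalEquality hiding ([_])
open import Function using (_∘_)
open import Function.Bundles using (_⇔_; mk⇔; Equivalence)
open import Function.Properties.Equivalence using () renaming (trans to ⇔-trans; sym to ⇔-sym)
open Equivalence using (to; from)

-- Splicing interval orders

record IntervalOrder (P : FinPoset) : Set where
  field
    start end : Fin (size P) → ℕ
    start<end : ∀ x → start x < end x
    ≼⇔ : ∀ x y → _≼_ P x y ⇔ (x ≡ y ⊎ end x ≤ start y)

  ≼-refl : ∀ x → _≼_ P x x
  ≼-refl x = from (≼⇔ x x) (inj₁ refl)

  ≼-trans : ∀ x y z → _≼_ P x y → _≼_ P y z → _≼_ P x z
  ≼-trans x y z x≼y y≼z with to (≼⇔ x y) x≼y | to (≼⇔ y z) y≼z
  ... | inj₁ refl | _ = y≼z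
  ... | inj₂ _ | inj₁ refl = x≼y
  ... | inj₂ x<y | inj₂ y<z = from (≼⇔ x z) (inj₂ (≤-trans x<y (≤-trans (<⇒≤ (start<end y)) y<z)))

shift : ∀ {P} → ℕ → IntervalOrder P → IntervalOrder P
shift r I = record
  { start = λ x → r + start x
  ; end = λ x → r + end x
  ; start<end = λ x → +-monoʳ-< r (start<end x)
  ; ≼⇔ = λ x y → ⇔-trans (≼⇔ x y) (mk⇔ (Sum.map₂ (+-monoʳ-≤ r)) (Sum.map₂ (+-cancelˡ-≤ r _ _)))
  }
  where open IntervalOrder I

module _ {P : FinPoset} (I : IntervalOrder P) where
  open IntervalOrder I

  record TopShape (N : ℕ) (p₀ p₁ : Fin (size P)) : Set where
    field
      p₀≢p₁ : p₀ ≢ p₁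
      start≤ : ∀ x → start x ≤ N
      end≤ : ∀ x → x ≢ p₀ → x ≢ p₁ → end x ≤ N
      <end₀ : N < end p₀
      <end₁ : N < end p₁
      start₀ : start p₀ ≡ N
      witness : Fin (size P)
      end-witness≤ : end witness ≤ N
      witness⋠p₁ : ¬ _≼_ P witness p₁

  record BottomShape (N : ℕ) (q₀ q₁ : Fin (size P)) : Set where
    field
      q₀≢q₁ : q₀ ≢ q₁
      <end : ∀ x → N < end x
      <start : ∀ x → x ≢ q₀ → x ≢ q₁ → N < start x
      start₀≤ : start q₀ ≤ N
      start₁≤ : start q₁ ≤ N
      end₀ : end q₀ ≡ suc N
      witness : Fin (size P)
      <start-witness : N < start witness
      q₁⋠witness : ¬ _≼_ P q₁ witness

  TopShape⇒SpliceLeft : ∀ {N p₀ p₁} → TopShape N p₀ p₁ → SpliceLeft P p₀ p₁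
  TopShape⇒SpliceLeft {N} {p₀} {p₁} top =
    p₀≢p₁ , max₀ , max₁ , only-max , (max₀ , below₀) ,
    λ (_ , below₁) → witness⋠p₁ (below₁ witness witness-not-max)
    where
    open TopShape top
    reaches-past⇒max : ∀ x → N < end x → Maximal P x
    reaches-past⇒max x N<end y x≼y with to (≼⇔ x y) x≼y
    ... | inj₁ x≡y = sym x≡y
    ... | inj₂ end≤start = ⊥-elim (<⇒≱ N<end (≤-trans end≤start (start≤ y)))
    max₀ : Maximal P p₀
    max₀ = reaches-past⇒max p₀ <end₀
    max₁ : Maximal P p₁
    max₁ = reaches-past⇒max p₁ <end₁
    ≼p₀ : ∀ x → end x ≤ N → _≼_ P x p₀
    ≼p₀ x end≤N = from (≼⇔ x p₀) (inj₂ (subst (end x ≤_) (sym start₀) end≤N))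
    not-max⇒end≤ : ∀ x → ¬ Maximal P x → end x ≤ N
    not-max⇒end≤ x ¬max = end≤ x (λ { refl → ¬max max₀ }) (λ { refl → ¬max max₁ })
    only-max : ∀ x → Maximal P x → x ≡ p₀ ⊎ x ≡ p₁
    only-max x max with x ≟ p₀ | x ≟ p₁
    ... | yes x≡p₀ | _ = inj₁ x≡p₀
    ... | no _ | yes x≡p₁ = inj₂ x≡p₁
    ... | no x≢p₀ | no x≢p₁ = inj₁ (sym (max p₀ (≼p₀ x (end≤ x x≢p₀ x≢p₁))))
    below₀ : ∀ x → ¬ Maximal P x → _≼_ P x p₀
    below₀ x ¬max = ≼p₀ x (not-max⇒end≤ x ¬max)
    witness-not-max : ¬ Maximal P witness
    witness-not-max max =
      <⇒≱ <end₀ (subst (λ x → end x ≤ N) (sym (max p₀ (≼p₀ witness end-witness≤))) end-witness≤)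

  BottomShape⇒SpliceRight : ∀ {N q₀ q₁} → BottomShape N q₀ q₁ → SpliceRight P q₀ q₁
  BottomShape⇒SpliceRight {N} {q₀} {q₁} bot =
    q₀≢q₁ , min₀ , min₁ , only-min , (min₀ , above₀) ,
    λ (_ , above₁) → q₁⋠witness (above₁ witness witness-not-min)
    where
    open BottomShape bot
    starts-by⇒min : ∀ x → start x ≤ N → Minimal P x
    starts-by⇒min x start≤N y y≼x with to (≼⇔ y x) y≼x
    ... | inj₁ y≡x = y≡x
    ... | inj₂ end≤start = ⊥-elim (<⇒≱ (<end y) (≤-trans end≤start start≤N))
    min₀ : Minimal P q₀
    min₀ = starts-by⇒min q₀ start₀≤
    min₁ : Minimal P q₁
    min₁ = starts-by⇒min q₁ start₁≤
    q₀≼ : ∀ x → N < start x → _≼_ P q₀ x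
    q₀≼ x N<start = from (≼⇔ q₀ x) (inj₂ (subst (_≤ start x) (sym end₀) N<start))
    not-min⇒<start : ∀ x → ¬ Minimal P x → N < start x
    not-min⇒<start x ¬min = <start x (λ { refl → ¬min min₀ }) (λ { refl → ¬min min₁ })
    only-min : ∀ x → Minimal P x → x ≡ q₀ ⊎ x ≡ q₁
    only-min x min with x ≟ q₀ | x ≟ q₁
    ... | yes x≡q₀ | _ = inj₁ x≡q₀
    ... | no _ | yes x≡q₁ = inj₂ x≡q₁
    ... | no x≢q₀ | no x≢q₁ = inj₁ (sym (min q₀ (q₀≼ x (<start x x≢q₀ x≢q₁))))
    above₀ : ∀ x → ¬ Minimal P x → _≼_ P q₀ x
    above₀ x ¬min = q₀≼ x (not-min⇒<start x ¬min)
    witness-not-min : ¬ Minimal P witness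
    witness-not-min min =
      <⇒≱ <start-witness (subst (λ x → start x ≤ N) (min q₀ (q₀≼ witness <start-witness)) start₀≤)

BottomShape-shift : ∀ {P} {I : IntervalOrder P} {N q₀ q₁} r →
                    BottomShape I N q₀ q₁ → BottomShape (shift r I) (r + N) q₀ q₁
BottomShape-shift {N = N} {q₀} r bot = record
  { q₀≢q₁ = q₀≢q₁
  ; <end = λ x → +-monoʳ-< r (<end x)
  ; <start = λ x x≢q₀ x≢q₁ → +-monoʳ-< r (<start x x≢q₀ x≢q₁)
  ; start₀≤ = +-monoʳ-≤ r start₀≤
  ; start₁≤ = +-monoʳ-≤ r start₁≤
  ; end₀ = trans (cong (r +_) end₀) (+-suc r N)
  ; witness = witness
  ; <start-witness = +-monoʳ-< r <start-witness
  ; q₁⋠witness = q₁⋠witness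
  }
  where open BottomShape bot

SpliceLeft-unique : ∀ {P p₀ p₁ p₀′ p₁′} →
                    SpliceLeft P p₀ p₁ → SpliceLeft P p₀′ p₁′ → p₀′ ≡ p₀ × p₁′ ≡ p₁
SpliceLeft-unique (_ , _ , _ , only-max , _ , ¬super₁) (p₀′≢p₁′ , max₀′ , max₁′ , _ , super₀′ , _)
  with only-max _ max₀′
... | inj₂ refl = ⊥-elim (¬super₁ super₀′)
... | inj₁ refl with only-max _ max₁′
...   | inj₁ refl = ⊥-elim (p₀′≢p₁′ refl)
...   | inj₂ p₁′≡p₁ = refl , p₁′≡p₁

SpliceRight-unique : ∀ {P q₀ q₁ q₀′ q₁′} →
                     SpliceRight P q₀ q₁ → SpliceRight P q₀′ q₁′ → q₀′ ≡ q₀ × q₁′ ≡ q₁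
SpliceRight-unique (_ , _ , _ , only-min , _ , ¬super₁) (q₀′≢q₁′ , min₀′ , min₁′ , _ , super₀′ , _)
  with only-min _ min₀′
... | inj₂ refl = ⊥-elim (¬super₁ super₀′)
... | inj₁ refl with only-min _ min₁′
...   | inj₁ refl = ⊥-elim (q₀′≢q₁′ refl)
...   | inj₂ q₁′≡q₁ = refl , q₁′≡q₁

SpliceIso : FinPoset → FinPoset → FinPoset → Set
SpliceIso P Q R =
  (Σ[ p₀ ∈ _ ] Σ[ p₁ ∈ _ ] SpliceLeft P p₀ p₁)
  × (Σ[ q₀ ∈ _ ] Σ[ q₁ ∈ _ ] SpliceRight Q q₀ q₁)
  × (∀ p₀ p₁ q₀ q₁ → SpliceLeft P p₀ p₁ → SpliceRight Q q₀ q₁ → Splice.IsoTo P Q p₀ p₁ q₀ q₁ R)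

SpliceIso-intro : ∀ {P Q R p₀ p₁ q₀ q₁} → SpliceLeft P p₀ p₁ → SpliceRight Q q₀ q₁ →
                  Splice.IsoTo P Q p₀ p₁ q₀ q₁ R → SpliceIso P Q R
SpliceIso-intro {P} {Q} {R} left right iso = (_ , _ , left) , (_ , _ , right) , for-all
  where
  for-all : ∀ p₀′ p₁′ q₀′ q₁′ → SpliceLeft P p₀′ p₁′ → SpliceRight Q q₀′ q₁′ →
            Splice.IsoTo P Q p₀′ p₁′ q₀′ q₁′ R
  for-all _ _ _ _ left′ right′ with SpliceLeft-unique left left′ | SpliceRight-unique right right′
  ... | refl , refl | refl , refl = iso

module SpliceOfIntervalOrders
  {P Q R : FinPoset} (IP : IntervalOrder P) (IQ : IntervalOrder Q) (IR : IntervalOrder R)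
  {N : ℕ} {p₀ p₁ : Fin (size P)} {q₀ q₁ : Fin (size Q)}
  (top : TopShape IP N p₀ p₁) (bottom : BottomShape IQ N q₀ q₁)
  (f₁ : Fin (size P) → Fin (size R)) (f₂ : Fin (size Q) → Fin (size R))
  (f₁-injective : ∀ x y → f₁ x ≡ f₁ y → x ≡ y)
  (f₂-injective : ∀ x y → f₂ x ≡ f₂ y → x ≡ y)
  (f-covers : ∀ z → (Σ[ x ∈ _ ] f₁ x ≡ z) ⊎ (Σ[ y ∈ _ ] f₂ y ≡ z))
  (glue₀ : f₁ p₀ ≡ f₂ q₀) (glue₁ : f₁ p₁ ≡ f₂ q₁)
  (start-f₁ : ∀ x → IntervalOrder.start IR (f₁ x) ≡ IntervalOrder.start IP x)
  (end-f₁ : ∀ x → IntervalOrder.end IP x ≤ N → IntervalOrder.end IR (f₁ x) ≡ IntervalOrder.end IP x)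
  (end-f₂ : ∀ y → IntervalOrder.end IR (f₂ y) ≡ IntervalOrder.end IQ y)
  (start-f₂ : ∀ y → N < IntervalOrder.start IQ y → IntervalOrder.start IR (f₂ y) ≡ IntervalOrder.start IQ y)
  where

  open IntervalOrder IP using () renaming (start to sP; end to eP; ≼⇔ to ≼P⇔; ≼-refl to ≼P-refl)
  open IntervalOrder IQ using () renaming (start to sQ; end to eQ; ≼⇔ to ≼Q⇔; ≼-refl to ≼Q-refl)
  open IntervalOrder IR using () renaming (start to sR; end to eR; ≼⇔ to ≼R⇔; ≼-trans to ≼R-trans)
  open TopShape top
  open BottomShape bottom using (<end; <start; start₀≤; start₁≤; end₀)
  open Splice P Q p₀ p₁ q₀ q₁

  f : Carrier → Fin (size R)
  f (inj₁ x) = f₁ x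
  f (inj₂ y) = f₂ y

  N-separates : ∀ {m n} → m ≤ N → N < n → ¬ n ≤ m
  N-separates m≤N N<n n≤m = <⇒≱ N<n (≤-trans n≤m m≤N)

  glued : ∀ x y → f₁ x ≡ f₂ y → (x ≡ p₀ × y ≡ q₀) ⊎ (x ≡ p₁ × y ≡ q₁)
  glued x y e with y ≟ q₀ | y ≟ q₁
  ... | yes refl | _ = inj₁ (f₁-injective x p₀ (trans e (sym glue₀)) , refl)
  ... | no _ | yes refl = inj₂ (f₁-injective x p₁ (trans e (sym glue₁)) , refl)
  ... | no y≢q₀ | no y≢q₁ = ⊥-elim (N-separates (start≤ x) N<start
          (≤-reflexive (trans (sym (start-f₂ y N<start)) (trans (cong sR (sym e)) (start-f₁ x)))))
    where
    N<start : N < sQ y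
    N<start = <start y y≢q₀ y≢q₁

  Ident⇒≡ : ∀ u v → Ident u v → f u ≡ f v
  Ident⇒≡ u .u (inj₁ refl) = refl
  Ident⇒≡ _ _ (inj₂ (inj₁ (refl , refl))) = glue₀
  Ident⇒≡ _ _ (inj₂ (inj₂ (inj₁ (refl , refl)))) = sym glue₀
  Ident⇒≡ _ _ (inj₂ (inj₂ (inj₂ (inj₁ (refl , refl))))) = glue₁
  Ident⇒≡ _ _ (inj₂ (inj₂ (inj₂ (inj₂ (refl , refl))))) = sym glue₁

  ≡⇒Ident : ∀ u v → f u ≡ f v → Ident u v
  ≡⇒Ident (inj₁ x) (inj₁ y) e = inj₁ (cong inj₁ (f₁-injective x y e))
  ≡⇒Ident (inj₂ x) (inj₂ y) e = inj₁ (cong inj₂ (f₂-injective x y e))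
  ≡⇒Ident (inj₁ x) (inj₂ y) e with glued x y e
  ... | inj₁ (refl , refl) = inj₂ (inj₁ (refl , refl))
  ... | inj₂ (refl , refl) = inj₂ (inj₂ (inj₂ (inj₁ (refl , refl))))
  ≡⇒Ident (inj₂ y) (inj₁ x) e with glued x y (sym e)
  ... | inj₁ (refl , refl) = inj₂ (inj₂ (inj₁ (refl , refl)))
  ... | inj₂ (refl , refl) = inj₂ (inj₂ (inj₂ (inj₂ (refl , refl))))

  end-f₁-below : ∀ x → eR (f₁ x) ≤ N → eR (f₁ x) ≡ eP x
  end-f₁-below x end≤N with x ≟ p₀ | x ≟ p₁
  ... | yes refl | _ = ⊥-elim (<⇒≱ (<end q₀) (subst (_≤ N) (trans (cong eR glue₀) (end-f₂ q₀)) end≤N))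
  ... | no _ | yes refl = ⊥-elim (<⇒≱ (<end q₁) (subst (_≤ N) (trans (cong eR glue₁) (end-f₂ q₁)) end≤N))
  ... | no x≢p₀ | no x≢p₁ = end-f₁ x (end≤ x x≢p₀ x≢p₁)

  start-f₂-above : ∀ y → N < sR (f₂ y) → sR (f₂ y) ≡ sQ y
  start-f₂-above y N<start with y ≟ q₀ | y ≟ q₁
  ... | yes refl | _ =
    ⊥-elim (<⇒≱ N<start (subst (_≤ N) (trans (sym (start-f₁ p₀)) (cong sR glue₀)) (start≤ p₀)))
  ... | no _ | yes refl =
    ⊥-elim (<⇒≱ N<start (subst (_≤ N) (trans (sym (start-f₁ p₁)) (cong sR glue₁)) (start≤ p₁)))
  ... | no y≢q₀ | no y≢q₁ = start-f₂ y (<start y y≢q₀ y≢q₁)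

  ≼R-from : ∀ {z w} → eR z ≤ sR w → _≼_ R z w
  ≼R-from e≤s = from (≼R⇔ _ _) (inj₂ e≤s)

  SLe⇒≼ : ∀ u v → SLe u v → _≼_ R (f u) (f v)
  SLe⇒≼ (inj₁ x) (inj₁ y) x≼y with to (≼P⇔ x y) x≼y
  ... | inj₁ refl = from (≼R⇔ _ _) (inj₁ refl)
  ... | inj₂ e≤s = ≼R-from (subst₂ _≤_ (sym (end-f₁ x (≤-trans e≤s (start≤ y)))) (sym (start-f₁ y)) e≤s)
  SLe⇒≼ (inj₂ x) (inj₂ y) x≼y with to (≼Q⇔ x y) x≼y
  ... | inj₁ refl = from (≼R⇔ _ _) (inj₁ refl)
  ... | inj₂ e≤s = ≼R-from (subst₂ _≤_ (sym (end-f₂ x)) (sym (start-f₂ y (<-≤-trans (<end x) e≤s))) e≤s)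
  SLe⇒≼ (inj₁ x) (inj₂ y) (inj₁ (x≼p₀ , q₀≼y)) = ≼R-trans _ _ _ (SLe⇒≼ (inj₁ x) (inj₁ p₀) x≼p₀)
    (subst (λ z → _≼_ R z (f₂ y)) (sym glue₀) (SLe⇒≼ (inj₂ q₀) (inj₂ y) q₀≼y))
  SLe⇒≼ (inj₁ x) (inj₂ y) (inj₂ (x≼p₁ , q₁≼y)) = ≼R-trans _ _ _ (SLe⇒≼ (inj₁ x) (inj₁ p₁) x≼p₁)
    (subst (λ z → _≼_ R z (f₂ y)) (sym glue₁) (SLe⇒≼ (inj₂ q₁) (inj₂ y) q₁≼y))

  SLe⇒QLe : ∀ {u v} → SLe u v → QLe u v
  SLe⇒QLe s = _ , _ , inj₁ refl , inj₁ refl , s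

  Ident⇒QLe : ∀ u v → Ident u v → QLe u v
  Ident⇒QLe u (inj₁ x) i = inj₁ x , inj₁ x , i , inj₁ refl , ≼P-refl x
  Ident⇒QLe u (inj₂ y) i = inj₂ y , inj₂ y , i , inj₁ refl , ≼Q-refl y

  ≼p₀ : ∀ x → eP x ≤ N → _≼_ P x p₀
  ≼p₀ x e≤N = from (≼P⇔ x p₀) (inj₂ (subst (eP x ≤_) (sym start₀) e≤N))

  q₀≼ : ∀ y → N < sQ y → _≼_ Q q₀ y
  q₀≼ y N<s = from (≼Q⇔ q₀ y) (inj₂ (subst (_≤ sQ y) (sym end₀) N<s))

  apart-across : ∀ x y → eR (f₁ x) ≤ sR (f₂ y) → SLe (inj₁ x) (inj₂ y)
  apart-across x y h with eR (f₁ x) ≤? N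
  ... | yes e≤N with y ≟ q₀ | y ≟ q₁
  ...   | yes refl | _ = inj₁ (≼p₀ x eP≤N , ≼Q-refl q₀)
    where
    eP≤N : eP x ≤ N
    eP≤N = subst (_≤ N) (end-f₁-below x e≤N) e≤N
  ...   | no _ | yes refl = inj₂ (from (≼P⇔ x p₁) (inj₂ eP≤sP) , ≼Q-refl q₁)
    where
    eP≤sP : eP x ≤ sP p₁
    eP≤sP = subst₂ _≤_ (end-f₁-below x e≤N) (trans (cong sR (sym glue₁)) (start-f₁ p₁)) h
  ...   | no y≢q₀ | no y≢q₁ =
    inj₁ (≼p₀ x (subst (_≤ N) (end-f₁-below x e≤N) e≤N) , q₀≼ y (<start y y≢q₀ y≢q₁))
  apart-across x y h | no e≰N with x ≟ p₀ | x ≟ p₁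
  ...   | yes refl | _ = inj₁ (≼P-refl p₀ , from (≼Q⇔ q₀ y) (inj₂ (subst₂ _≤_ eq (start-f₂-above y N<s) h)))
    where
    eq : eR (f₁ p₀) ≡ eQ q₀
    eq = trans (cong eR glue₀) (end-f₂ q₀)
    N<s : N < sR (f₂ y)
    N<s = <-≤-trans (≰⇒> e≰N) h
  ...   | no _ | yes refl = inj₂ (≼P-refl p₁ , from (≼Q⇔ q₁ y) (inj₂ (subst₂ _≤_ eq (start-f₂-above y N<s) h)))
    where
    eq : eR (f₁ p₁) ≡ eQ q₁
    eq = trans (cong eR glue₁) (end-f₂ q₁)
    N<s : N < sR (f₂ y)
    N<s = <-≤-trans (≰⇒> e≰N) h
  ...   | no x≢p₀ | no x≢p₁ = ⊥-elim (e≰N (subst (_≤ N) (sym (end-f₁ x e≤N)) e≤N))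
    where
    e≤N : eP x ≤ N
    e≤N = end≤ x x≢p₀ x≢p₁

  apart⇒QLe : ∀ u v → eR (f u) ≤ sR (f v) → QLe u v
  apart⇒QLe (inj₁ x) (inj₁ y) h =
    SLe⇒QLe (from (≼P⇔ x y) (inj₂ (subst₂ _≤_ (end-f₁-below x e≤N) (start-f₁ y) h)))
    where
    e≤N : eR (f₁ x) ≤ N
    e≤N = ≤-trans h (≤-trans (≤-reflexive (start-f₁ y)) (start≤ y))
  apart⇒QLe (inj₂ x) (inj₂ y) h =
    SLe⇒QLe (from (≼Q⇔ x y) (inj₂ (subst₂ _≤_ (end-f₂ x) (start-f₂-above y N<s) h)))
    where
    N<s : N < sR (f₂ y)
    N<s = <-≤-trans (subst (N <_) (sym (end-f₂ x)) (<end x)) h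
  apart⇒QLe (inj₂ x) (inj₁ y) h = ⊥-elim (N-separates (start≤ y) (<end x) (subst₂ _≤_ (end-f₂ x) (start-f₁ y) h))
  apart⇒QLe (inj₁ x) (inj₂ y) h = SLe⇒QLe (apart-across x y h)

  ≼⇒QLe : ∀ u v → _≼_ R (f u) (f v) → QLe u v
  ≼⇒QLe u v fu≼fv with to (≼R⇔ (f u) (f v)) fu≼fv
  ... | inj₁ e = Ident⇒QLe u v (≡⇒Ident u v e)
  ... | inj₂ h = apart⇒QLe u v h

  QLe⇒≼ : ∀ u v → QLe u v → _≼_ R (f u) (f v)
  QLe⇒≼ u v (u′ , v′ , u~u′ , v~v′ , s) =
    subst₂ (_≼_ R) (sym (Ident⇒≡ u u′ u~u′)) (sym (Ident⇒≡ v v′ v~v′)) (SLe⇒≼ u′ v′ s)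

  isoTo : IsoTo R
  isoTo = f , covers , (λ u v → mk⇔ (≡⇒Ident u v) (Ident⇒≡ u v)) , (λ u v → mk⇔ (≼⇒QLe u v) (QLe⇒≼ u v))
    where
    covers : ∀ z → Σ[ u ∈ Carrier ] f u ≡ z
    covers z with f-covers z
    ... | inj₁ (x , e) = inj₁ x , e
    ... | inj₂ (y , e) = inj₂ y , e

-- Invariance of splicing under isomorphism

record _≅_ (P Q : FinPoset) : Set where
  field
    fun : Fin (size P) → Fin (size Q)
    inv : Fin (size Q) → Fin (size P)
    inv∘fun : ∀ x → inv (fun x) ≡ x
    fun∘inv : ∀ y → fun (inv y) ≡ y
    ≼⇔ : ∀ x y → _≼_ P x y ⇔ _≼_ Q (fun x) (fun y)

  ≼-inv : ∀ x y → _≼_ Q x y → _≼_ P (inv x) (inv y)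
  ≼-inv x y x≼y = from (≼⇔ (inv x) (inv y)) (subst₂ (_≼_ Q) (sym (fun∘inv x)) (sym (fun∘inv y)) x≼y)

≅-sym : ∀ {P Q} → P ≅ Q → Q ≅ P
≅-sym {Q = Q} σ = record
  { fun = inv ; inv = fun ; inv∘fun = fun∘inv ; fun∘inv = inv∘fun
  ; ≼⇔ = λ x y → mk⇔ (≼-inv x y)
      (λ x≼y → subst₂ (_≼_ Q) (fun∘inv x) (fun∘inv y) (to (≼⇔ (inv x) (inv y)) x≼y))
  }
  where open _≅_ σ

module _ {P Q : FinPoset} (σ : P ≅ Q) where
  open _≅_ σ

  Minimal-≅ : ∀ {x} → Minimal P x → Minimal Q (fun x)
  Minimal-≅ {x} min y y≼x =
    trans (sym (fun∘inv y)) (cong fun (min (inv y) (subst (_≼_ P (inv y)) (inv∘fun x) (≼-inv y (fun x) y≼x))))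

  Superminimal-≅ : ∀ {x} → Superminimal P x → Superminimal Q (fun x)
  Superminimal-≅ {x} (min , above) = Minimal-≅ min , λ y ¬min →
    subst (_≼_ Q (fun x)) (fun∘inv y)
      (to (≼⇔ x (inv y)) (above (inv y) λ min′ → ¬min (subst (Minimal Q) (fun∘inv y) (Minimal-≅ min′))))

  fun-injective : ∀ {x y} → fun x ≡ fun y → x ≡ y
  fun-injective {x} {y} e = trans (sym (inv∘fun x)) (trans (cong inv e) (inv∘fun y))

SpliceRight-≅ : ∀ {P Q q₀ q₁} (σ : P ≅ Q) → SpliceRight P q₀ q₁ →
                SpliceRight Q (_≅_.fun σ q₀) (_≅_.fun σ q₁)
SpliceRight-≅ {P} {Q} {q₀} {q₁} σ (q₀≢q₁ , min₀ , min₁ , only-min , super₀ , ¬super₁) =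
  (λ e → q₀≢q₁ (fun-injective σ e)) , Minimal-≅ σ min₀ , Minimal-≅ σ min₁ , only-min′ ,
  Superminimal-≅ σ super₀ ,
  λ super → ¬super₁ (subst (Superminimal P) (inv∘fun q₁) (Superminimal-≅ (≅-sym σ) super))
  where
  open _≅_ σ
  back : ∀ {y x} → inv y ≡ x → y ≡ fun x
  back {y} e = trans (sym (fun∘inv y)) (cong fun e)
  only-min′ : ∀ y → Minimal Q y → y ≡ fun q₀ ⊎ y ≡ fun q₁
  only-min′ y min with only-min (inv y) (Minimal-≅ (≅-sym σ) min)
  ... | inj₁ e = inj₁ (back e)
  ... | inj₂ e = inj₂ (back e)

module _ {P Q Q′ R : FinPoset} {p₀ p₁ : Fin (size P)} {q₀ q₁ : Fin (size Q)} (σ : Q ≅ Q′) where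
  open _≅_ σ
  private
    module S = Splice P Q p₀ p₁ q₀ q₁
    module S′ = Splice P Q′ p₀ p₁ (fun q₀) (fun q₁)

    τ : S.Carrier → S′.Carrier
    τ = Sum.map₂ fun

    τ⁻¹ : S′.Carrier → S.Carrier
    τ⁻¹ = Sum.map₂ inv

    τ∘τ⁻¹ : ∀ u → τ (τ⁻¹ u) ≡ u
    τ∘τ⁻¹ (inj₁ x) = refl
    τ∘τ⁻¹ (inj₂ y) = cong inj₂ (fun∘inv y)

    τ⁻¹∘τ : ∀ u → τ⁻¹ (τ u) ≡ u
    τ⁻¹∘τ (inj₁ x) = refl
    τ⁻¹∘τ (inj₂ y) = cong inj₂ (inv∘fun y)

    τ-injective : ∀ {u v} → τ u ≡ τ v → u ≡ v
    τ-injective {u} {v} e = trans (sym (τ⁻¹∘τ u)) (trans (cong τ⁻¹ e) (τ⁻¹∘τ v))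

    Ident-τ : ∀ u v → S′.Ident (τ u) (τ v) ⇔ S.Ident u v
    Ident-τ u v = mk⇔ ⇒ ⇐
      where
      ⇒ : S′.Ident (τ u) (τ v) → S.Ident u v
      ⇒ (inj₁ e) = inj₁ (τ-injective e)
      ⇒ (inj₂ (inj₁ (e , e′))) = inj₂ (inj₁ (τ-injective e , τ-injective e′))
      ⇒ (inj₂ (inj₂ (inj₁ (e , e′)))) = inj₂ (inj₂ (inj₁ (τ-injective e , τ-injective e′)))
      ⇒ (inj₂ (inj₂ (inj₂ (inj₁ (e , e′))))) = inj₂ (inj₂ (inj₂ (inj₁ (τ-injective e , τ-injective e′))))
      ⇒ (inj₂ (inj₂ (inj₂ (inj₂ (e , e′))))) = inj₂ (inj₂ (inj₂ (inj₂ (τ-injective e , τ-injective e′))))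
      ⇐ : S.Ident u v → S′.Ident (τ u) (τ v)
      ⇐ (inj₁ e) = inj₁ (cong τ e)
      ⇐ (inj₂ (inj₁ (e , e′))) = inj₂ (inj₁ (cong τ e , cong τ e′))
      ⇐ (inj₂ (inj₂ (inj₁ (e , e′)))) = inj₂ (inj₂ (inj₁ (cong τ e , cong τ e′)))
      ⇐ (inj₂ (inj₂ (inj₂ (inj₁ (e , e′))))) = inj₂ (inj₂ (inj₂ (inj₁ (cong τ e , cong τ e′))))
      ⇐ (inj₂ (inj₂ (inj₂ (inj₂ (e , e′))))) = inj₂ (inj₂ (inj₂ (inj₂ (cong τ e , cong τ e′))))

    SLe-τ : ∀ u v → S′.SLe (τ u) (τ v) ⇔ S.SLe u v
    SLe-τ (inj₁ x) (inj₁ y) = mk⇔ (λ s → s) (λ s → s)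
    SLe-τ (inj₂ x) (inj₂ y) = ⇔-sym (≼⇔ x y)
    SLe-τ (inj₂ x) (inj₁ y) = mk⇔ (λ ()) (λ ())
    SLe-τ (inj₁ x) (inj₂ y) =
      mk⇔ (Sum.map (Product.map₂ (from (≼⇔ q₀ y))) (Product.map₂ (from (≼⇔ q₁ y))))
          (Sum.map (Product.map₂ (to (≼⇔ q₀ y))) (Product.map₂ (to (≼⇔ q₁ y))))

    QLe-τ : ∀ u v → S′.QLe (τ u) (τ v) ⇔ S.QLe u v
    QLe-τ u v = mk⇔ ⇒ ⇐
      where
      ⇒ : S′.QLe (τ u) (τ v) → S.QLe u v
      ⇒ (u′ , v′ , u~u′ , v~v′ , s) =
        τ⁻¹ u′ , τ⁻¹ v′ ,
        to (Ident-τ u (τ⁻¹ u′)) (subst (S′.Ident (τ u)) (sym (τ∘τ⁻¹ u′)) u~u′) ,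
        to (Ident-τ v (τ⁻¹ v′)) (subst (S′.Ident (τ v)) (sym (τ∘τ⁻¹ v′)) v~v′) ,
        to (SLe-τ (τ⁻¹ u′) (τ⁻¹ v′)) (subst₂ S′.SLe (sym (τ∘τ⁻¹ u′)) (sym (τ∘τ⁻¹ v′)) s)
      ⇐ : S.QLe u v → S′.QLe (τ u) (τ v)
      ⇐ (u′ , v′ , u~u′ , v~v′ , s) =
        τ u′ , τ v′ , from (Ident-τ u u′) u~u′ , from (Ident-τ v v′) v~v′ , from (SLe-τ u′ v′) s

  IsoTo-≅ : Splice.IsoTo P Q′ p₀ p₁ (fun q₀) (fun q₁) R → Splice.IsoTo P Q p₀ p₁ q₀ q₁ R
  IsoTo-≅ (g , g-covers , g-ident , g-order) =
    (λ u → g (τ u)) , covers ,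
    (λ u v → ⇔-trans (g-ident (τ u) (τ v)) (Ident-τ u v)) ,
    (λ u v → ⇔-trans (g-order (τ u) (τ v)) (QLe-τ u v))
    where
    covers : ∀ z → Σ[ u ∈ S.Carrier ] g (τ u) ≡ z
    covers z with g-covers z
    ... | u , gu≡z = τ⁻¹ u , trans (cong g (τ∘τ⁻¹ u)) gu≡z

SpliceIso-≅ : ∀ {P Q Q′ R} → Q ≅ Q′ → SpliceIso P Q′ R → SpliceIso P Q R
SpliceIso-≅ {P} {Q} {Q′} {R} σ (left , (q₀ , q₁ , right) , isos) =
  left , (inv q₀ , inv q₁ , SpliceRight-≅ (≅-sym σ) right) ,
  λ p₀ p₁ q₀ q₁ left′ right′ → IsoTo-≅ {P} {Q} {Q′} {R} {p₀} {p₁} {q₀} {q₁} σ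
                                  (isos p₀ p₁ (fun q₀) (fun q₁) left′ (SpliceRight-≅ σ right′))
  where open _≅_ σ

-- Positions in a word

-- bit a t reads the word 0 a₁ … aₙ 1 1 1 …: position 0 is a sentinel 0 and every
-- position beyond n a sentinel 1.
bit : List Bool → ℕ → Bool
bit a zero = false
bit [] (suc _) = true
bit (x ∷ a) (suc zero) = x
bit (x ∷ a) (suc (suc t)) = bit a (suc t)

-- the first position after t carrying c, or n + 1 if there is none up to n
next : Bool → List Bool → ℕ → ℕ
next c [] t = 1
next c (x ∷ a) zero = if does (x ≟ᵇ c) then 1 else suc (next c a 0)
next c (x ∷ a) (suc t) = suc (next c a t)

prevStep : Bool → Bool → ℕ → ℕ
prevStep x c zero = if does (x ≟ᵇ c) then 1 else 0
prevStep x c (suc p) = suc (suc p)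

-- the last position p with 1 ≤ p < t and p ≤ n carrying c, or 0 if there is none
prev : Bool → List Bool → ℕ → ℕ
prev c a zero = 0
prev c a (suc zero) = 0
prev c [] (suc (suc t)) = 0
prev c (x ∷ a) (suc (suc t)) = prevStep x c (prev c a (suc t))

true≢false : true ≢ false
true≢false ()

bit-∷ : ∀ x a t → 1 ≤ t → bit (x ∷ a) (suc t) ≡ bit a t
bit-∷ x a (suc t) _ = refl

bit-beyond : ∀ a t → length a < t → bit a t ≡ true
bit-beyond [] (suc t) _ = refl
bit-beyond (x ∷ a) (suc (suc t)) (s≤s p) = bit-beyond a (suc t) p

bit≡false⇒≤length : ∀ a t → bit a t ≡ false → t ≤ length a
bit≡false⇒≤length a t e with t ≤? length a
... | yes p = p
... | no p with () ← trans (sym (bit-beyond a t (≰⇒> p))) e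

bit≡true⇒1≤ : ∀ a t → bit a t ≡ true → 1 ≤ t
bit≡true⇒1≤ a (suc t) _ = s≤s z≤n

1≤next : ∀ c a t → 1 ≤ next c a t
1≤next c [] t = s≤s z≤n
1≤next c (x ∷ a) zero with x ≟ᵇ c
... | yes _ = s≤s z≤n
... | no _ = s≤s z≤n
1≤next c (x ∷ a) (suc t) = s≤s z≤n

<next : ∀ c a t → t ≤ length a → t < next c a t
<next c [] zero _ = s≤s z≤n
<next c (x ∷ a) zero _ = 1≤next c (x ∷ a) zero
<next c (x ∷ a) (suc t) (s≤s p) = s≤s (<next c a t p)

next≤ : ∀ c a t → next c a t ≤ suc (length a)
next≤ c [] t = s≤s z≤n
next≤ c (x ∷ a) zero with x ≟ᵇ c
... | yes _ = s≤s z≤n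
... | no _ = s≤s (next≤ c a 0)
next≤ c (x ∷ a) (suc t) = s≤s (next≤ c a t)

bit-next : ∀ c a t → next c a t ≤ length a → bit a (next c a t) ≡ c
bit-next c [] t ()
bit-next c (x ∷ a) zero p with x ≟ᵇ c
... | yes x≡c = x≡c
... | no _ = trans (bit-∷ x a _ (1≤next c a 0)) (bit-next c a 0 (≤-pred p))
bit-next c (x ∷ a) (suc t) p = trans (bit-∷ x a _ (1≤next c a t)) (bit-next c a t (≤-pred p))

bit-next-beyond : ∀ a t → bit a (next true a t) ≡ true
bit-next-beyond a t with next true a t ≤? length a
... | yes p = bit-next true a t p
... | no p = bit-beyond a _ (≰⇒> p)

bit-before-next : ∀ c a t w → t < w → w < next c a t → bit a w ≢ c
bit-before-next c [] t w t<w w<n = ⊥-elim (<-irrefl refl (≤-trans (s≤s (≤-trans (s≤s z≤n) t<w)) w<n))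
bit-before-next c (x ∷ a) zero w t<w w<n with x ≟ᵇ c
bit-before-next c (x ∷ a) zero (suc w) (s≤s t<w) (s≤s w<n) | yes _ = ⊥-elim (<-irrefl refl (≤-trans (s≤s z≤n) w<n))
bit-before-next c (x ∷ a) zero (suc zero) _ _ | no x≢c = x≢c
bit-before-next c (x ∷ a) zero (suc (suc w)) _ (s≤s w<n) | no _ = bit-before-next c a 0 (suc w) (s≤s z≤n) w<n
bit-before-next c (x ∷ a) (suc t) (suc w) (s≤s t<w) (s≤s w<n)
  rewrite bit-∷ x a w (≤-trans (s≤s z≤n) t<w) = bit-before-next c a t w t<w w<n

prev-suc≤ : ∀ c a t → prev c a (suc t) ≤ t
prev-suc≤ c a zero = z≤n
prev-suc≤ c [] (suc t) = z≤n
prev-suc≤ c (x ∷ a) (suc t) with prev c a (suc t) | prev-suc≤ c a t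
... | suc p | p≤t = s≤s p≤t
... | zero | _ with x ≟ᵇ c
...   | yes _ = s≤s z≤n
...   | no _ = z≤n

prev< : ∀ c a t → 1 ≤ t → prev c a t < t
prev< c a (suc t) _ = s≤s (prev-suc≤ c a t)

prev≤length : ∀ c a t → prev c a t ≤ length a
prev≤length c a zero = z≤n
prev≤length c a (suc zero) = z≤n
prev≤length c [] (suc (suc t)) = z≤n
prev≤length c (x ∷ a) (suc (suc t)) with prev c a (suc t) | prev≤length c a (suc t)
... | suc p | p≤n = s≤s p≤n
... | zero | _ with x ≟ᵇ c
...   | yes _ = s≤s z≤n
...   | no _ = z≤n

bit-prev : ∀ c a t → 1 ≤ prev c a t → bit a (prev c a t) ≡ c
bit-prev c a zero ()
bit-prev c a (suc zero) ()
bit-prev c [] (suc (suc t)) ()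
bit-prev c (x ∷ a) (suc (suc t)) h with prev c a (suc t) | bit-prev c a (suc t)
... | suc p | ih = ih (s≤s z≤n)
... | zero | _ with x ≟ᵇ c
...   | yes x≡c = x≡c
bit-prev c (x ∷ a) (suc (suc t)) () | zero | _ | no _

bit-after-prev : ∀ c a t w → prev c a t < w → w < t → w ≤ length a → bit a w ≢ c
bit-after-prev c a zero w _ () _
bit-after-prev c a (suc zero) w p<w (s≤s w<t) _ = ⊥-elim (<-irrefl refl (≤-trans p<w w<t))
bit-after-prev c [] (suc (suc t)) zero () _ _
bit-after-prev c (x ∷ a) (suc (suc t)) w p<w w<t w≤n with prev c a (suc t) | bit-after-prev c a (suc t)
bit-after-prev c (x ∷ a) (suc (suc t)) zero () _ _ | _ | _
bit-after-prev c (x ∷ a) (suc (suc t)) (suc (suc w)) p<w (s≤s w<t) (s≤s w≤n) | zero | ih =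
  ih (suc w) (s≤s z≤n) w<t w≤n
bit-after-prev c (x ∷ a) (suc (suc t)) (suc (suc w)) (s≤s p<w) (s≤s w<t) (s≤s w≤n) | suc _ | ih =
  ih (suc w) p<w w<t w≤n
bit-after-prev c (x ∷ a) (suc (suc t)) (suc zero) (s≤s ()) _ _ | suc _ | _
bit-after-prev c (x ∷ a) (suc (suc t)) (suc zero) p<w _ _ | zero | _ with x ≟ᵇ c
bit-after-prev c (x ∷ a) (suc (suc t)) (suc zero) (s≤s ()) _ _ | zero | _ | yes _
... | no x≢c = x≢c

NextCandidate : Bool → List Bool → ℕ → Set
NextCandidate c a z = (z ≤ length a × bit a z ≡ c) ⊎ z ≡ suc (length a)

NextCandidate⇒≤ : ∀ {c} a {z} → NextCandidate c a z → z ≤ suc (length a)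
NextCandidate⇒≤ _ (inj₁ (z≤length , _)) = m≤n⇒m≤1+n z≤length
NextCandidate⇒≤ _ (inj₂ refl) = ≤-refl

next-unique : ∀ c a t z → t < z → NextCandidate c a z →
              (∀ w → t < w → w < z → bit a w ≢ c) → next c a t ≡ z
next-unique c a t z t<z hz gap with <-cmp (next c a t) z
... | tri≈ _ e _ = e
... | tri< n<z _ _ with next c a t ≤? length a
...   | yes n≤ = ⊥-elim (gap _ (<next c a t (≤-pred (≤-trans t<z (NextCandidate⇒≤ a hz)))) n<z (bit-next c a t n≤))
...   | no n≰ = ⊥-elim (<-irrefl refl (≤-trans (≤-trans (s≤s (≰⇒> n≰)) n<z) (NextCandidate⇒≤ a hz)))
next-unique c a t z t<z (inj₁ (_ , bz)) gap | tri> _ _ z<n = ⊥-elim (bit-before-next c a t z t<z z<n bz)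
next-unique c a t z t<z (inj₂ refl) gap | tri> _ _ z<n = ⊥-elim (<-irrefl refl (≤-trans z<n (next≤ c a t)))

prev-unique : ∀ c a t z → z < t → (1 ≤ z × z ≤ length a × bit a z ≡ c) ⊎ z ≡ 0 →
              (∀ w → z < w → w < t → w ≤ length a → bit a w ≢ c) → prev c a t ≡ z
prev-unique c a zero z () hz gap
prev-unique c a (suc t) z z<t hz gap with <-cmp (prev c a (suc t)) z
... | tri≈ _ e _ = e
prev-unique c a (suc t) z z<t (inj₁ (_ , z≤length , bz)) gap | tri< p<z _ _ =
  ⊥-elim (bit-after-prev c a (suc t) z p<z z<t z≤length bz)
prev-unique c a (suc t) .0 z<t (inj₂ refl) gap | tri< () _ _
... | tri> _ _ z<p = ⊥-elim (gap _ z<p (s≤s (prev-suc≤ c a t)) (prev≤length c a (suc t))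
                          (bit-prev c a (suc t) (≤-trans (s≤s z≤n) z<p)))

prev-next : ∀ c a k → k ≤ length a → k ≡ 0 ⊎ bit a k ≡ c → prev c a (next c a k) ≡ k
prev-next c a k k≤n hk = prev-unique c a (next c a k) k (<next c a k k≤n) (candidate k k≤n hk)
  (λ w k<w w<n _ → bit-before-next c a k w k<w w<n)
  where
  candidate : ∀ k → k ≤ length a → k ≡ 0 ⊎ bit a k ≡ c → (1 ≤ k × k ≤ length a × bit a k ≡ c) ⊎ k ≡ 0
  candidate zero _ _ = inj₂ refl
  candidate (suc k) k≤n (inj₂ e) = inj₁ (s≤s z≤n , k≤n , e)

next-prev : ∀ c a k → 1 ≤ k → NextCandidate c a k → next c a (prev c a k) ≡ k
next-prev c a (suc k) _ hk = next-unique c a (prev c a (suc k)) (suc k) (s≤s (prev-suc≤ c a k)) hk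
  (λ w p<w w<k → bit-after-prev c a (suc k) w p<w w<k (≤-pred (≤-trans w<k (NextCandidate⇒≤ a hk))))

NextCandidate-true : ∀ a t → t ≤ suc (length a) → bit a t ≡ true → NextCandidate true a t
NextCandidate-true a t t≤ e with t ≤? length a
... | yes t≤n = inj₁ (t≤n , e)
... | no t≰n = inj₂ (≤-antisym t≤ (≰⇒> t≰n))

bit-prev-false : ∀ a t → bit a (prev false a t) ≡ false
bit-prev-false a t with prev false a t in e
... | zero = refl
... | suc p = trans (cong (bit a) (sym e)) (bit-prev false a t (subst (1 ≤_) (sym e) (s≤s z≤n)))

-- 𝒫_a as an interval order

lo : List Bool → ℕ → ℕ
lo a t = if bit a t then prev true a t else t

hi : List Bool → ℕ → ℕ
hi a t = if bit a t then t else next false a t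

1≤hi : ∀ a t → 1 ≤ hi a t
1≤hi a zero = 1≤next false a 0
1≤hi a (suc t) with bit a (suc t)
... | true = s≤s z≤n
... | false = 1≤next false a (suc t)

lo≤length : ∀ a t → lo a t ≤ length a
lo≤length a t with bit a t in e
... | true = prev≤length true a t
... | false = bit≡false⇒≤length a t e

lo<hi : ∀ a t → lo a t < hi a t
lo<hi a t with bit a t in e
... | false = <next false a t (bit≡false⇒≤length a t e)
... | true = prev< true a t (bit≡true⇒1≤ a t e)

hi≤lo⇒< : ∀ a t t′ → hi a t ≤ lo a t′ → t < t′
hi≤lo⇒< a t t′ h with bit a t in e | bit a t′ in e′
... | false | false = <-≤-trans (<next false a t (bit≡false⇒≤length a t e)) h
... | true | true = ≤-<-trans h (prev< true a t′ (bit≡true⇒1≤ a t′ e′))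
... | false | true = <-≤-trans (<next false a t (bit≡false⇒≤length a t e))
                       (≤-trans h (<⇒≤ (prev< true a t′ (bit≡true⇒1≤ a t′ e′))))
... | true | false with <-cmp t t′
...   | tri< t<t′ _ _ = t<t′
...   | tri≈ _ refl _ with () ← trans (sym e) e′
...   | tri> _ _ t′<t = ⊥-elim (<-irrefl refl (<-≤-trans t′<t h))

hi-∷ : ∀ x a t → hi (x ∷ a) (suc (suc t)) ≡ suc (hi a (suc t))
hi-∷ x a t with bit a (suc t)
... | true = refl
... | false = refl

lo-∷ : ∀ x a t h → 1 ≤ h → suc h ≤ lo (x ∷ a) (suc (suc t)) ⇔ h ≤ lo a (suc t)
lo-∷ x a t h 1≤h with bit a (suc t)
... | false = mk⇔ ≤-pred s≤s
... | true with prev true a (suc t)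
...   | suc p = mk⇔ ≤-pred s≤s
...   | zero with x ≟ᵇ true
...     | yes _ = mk⇔ (λ q → ⊥-elim (<-irrefl refl (≤-trans (s≤s 1≤h) q)))
                     (λ q → ⊥-elim (<-irrefl refl (≤-trans 1≤h q)))
...     | no _ = mk⇔ (λ ()) (λ q → ⊥-elim (<-irrefl refl (≤-trans 1≤h q)))

1≤lo-true∷ : ∀ a t → 1 ≤ lo (true ∷ a) (suc (suc t))
1≤lo-true∷ a t with bit a (suc t)
... | false = s≤s z≤n
... | true with prev true a (suc t)
...   | zero = s≤s z≤n
...   | suc p = s≤s z≤n

1≤lo-false∷ : ∀ a t → 1 ≤ lo (false ∷ a) (suc (suc t)) ⇔ 1 ≤ lo a (suc t)
1≤lo-false∷ a t with bit a (suc t)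
... | false = mk⇔ (λ _ → s≤s z≤n) (λ _ → s≤s z≤n)
... | true with prev true a (suc t)
...   | zero = mk⇔ (λ ()) (λ ())
...   | suc p = mk⇔ (λ _ → s≤s z≤n) (λ _ → s≤s z≤n)

someAbove : List Bool → List Bool → Bool
someAbove (x ∷ xs) (y ∷ ys) = (x ∧ not y) ∨ someAbove xs ys
someAbove _ _ = false

someAbove-irrefl : ∀ xs → someAbove xs xs ≢ true
someAbove-irrefl [] = λ ()
someAbove-irrefl (true ∷ xs) = someAbove-irrefl xs
someAbove-irrefl (false ∷ xs) = someAbove-irrefl xs

Any-above⇔ : ∀ xs ys → Any (λ p → proj₁ p ≡ true × proj₂ p ≡ false) (zip xs ys) ⇔ someAbove xs ys ≡ true
Any-above⇔ [] ys = mk⇔ (λ ()) (λ ())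
Any-above⇔ (x ∷ xs) [] = mk⇔ (λ ()) (λ ())
Any-above⇔ (true ∷ xs) (false ∷ ys) = mk⇔ (λ _ → refl) (λ _ → here (refl , refl))
Any-above⇔ (true ∷ xs) (true ∷ ys) =
  mk⇔ (λ { (here (_ , ())) ; (there p) → to (Any-above⇔ xs ys) p }) (λ e → there (from (Any-above⇔ xs ys) e))
Any-above⇔ (false ∷ xs) (y ∷ ys) =
  mk⇔ (λ { (here (() , _)) ; (there p) → to (Any-above⇔ xs ys) p }) (λ e → there (from (Any-above⇔ xs ys) e))

Any-below⇔ : ∀ xs ys → Any (λ p → proj₁ p ≡ false × proj₂ p ≡ true) (zip xs ys) ⇔ someAbove ys xs ≡ true
Any-below⇔ [] [] = mk⇔ (λ ()) (λ ())
Any-below⇔ [] (y ∷ ys) = mk⇔ (λ ()) (λ ())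
Any-below⇔ (x ∷ xs) [] = mk⇔ (λ ()) (λ ())
Any-below⇔ (false ∷ xs) (true ∷ ys) = mk⇔ (λ _ → refl) (λ _ → here (refl , refl))
Any-below⇔ (false ∷ xs) (false ∷ ys) =
  mk⇔ (λ { (here (_ , ())) ; (there p) → to (Any-below⇔ xs ys) p }) (λ e → there (from (Any-below⇔ xs ys) e))
Any-below⇔ (true ∷ xs) (true ∷ ys) =
  mk⇔ (λ { (here (() , _)) ; (there p) → to (Any-below⇔ xs ys) p }) (λ e → there (from (Any-below⇔ xs ys) e))
Any-below⇔ (true ∷ xs) (false ∷ ys) =
  mk⇔ (λ { (here (() , _)) ; (there p) → to (Any-below⇔ xs ys) p }) (λ e → there (from (Any-below⇔ xs ys) e))

Opposed⇔ : ∀ xs ys → Opposed xs ys ⇔ (someAbove xs ys ≡ true × someAbove ys xs ≡ true)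
Opposed⇔ xs ys = mk⇔ (λ (p , q) → to (Any-above⇔ xs ys) p , to (Any-below⇔ xs ys) q)
                     (λ (p , q) → from (Any-above⇔ xs ys) p , from (Any-below⇔ xs ys) q)

ComparesAsIntervals : List Bool → ℕ → ℕ → Set
ComparesAsIntervals a i j =
  someAbove (ext a i) (ext a j) ≡ true × (someAbove (ext a j) (ext a i) ≡ true ⇔ hi a i ≤ lo a j)

ext-compare₀ : ∀ a j → j ≤ length a → ComparesAsIntervals a 0 (suc j)
ext-compare₀ [] zero _ = refl , mk⇔ (λ ()) (λ ())
ext-compare₀ (true ∷ a) zero _ = refl , mk⇔ (⊥-elim ∘ someAbove-irrefl a) (λ ())
ext-compare₀ (false ∷ a) zero _ = refl , mk⇔ (λ _ → s≤s z≤n) (λ _ → refl)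
ext-compare₀ (true ∷ a) (suc j) (s≤s j≤) =
  let above , sep = ext-compare₀ a j j≤
  in above , ⇔-trans sep (⇔-sym (lo-∷ true a j (hi a 0) (1≤hi a 0)))
ext-compare₀ (false ∷ []) (suc zero) _ = refl , mk⇔ (λ ()) (λ ())
ext-compare₀ (false ∷ []) (suc (suc j)) (s≤s ())
ext-compare₀ (false ∷ true ∷ a) (suc zero) _ =
  refl , mk⇔ (⊥-elim ∘ someAbove-irrefl a) (λ ())
ext-compare₀ (false ∷ false ∷ a) (suc zero) _ = refl , mk⇔ (λ _ → s≤s z≤n) (λ _ → refl)
ext-compare₀ (false ∷ true ∷ a) (suc (suc j)) _ =
  refl , mk⇔ (λ _ → <⇒≤ (from (lo-∷ false (true ∷ a) (suc j) 1 (s≤s z≤n)) (1≤lo-true∷ a j))) (λ _ → refl)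
ext-compare₀ (false ∷ false ∷ a) (suc (suc j)) (s≤s j≤) =
  refl , ⇔-trans (proj₂ (ext-compare₀ (false ∷ a) (suc j) j≤)) (⇔-sym (1≤lo-false∷ (false ∷ a) (suc j)))

ext-compare : ∀ a i j → i < j → j ≤ suc (length a) → ComparesAsIntervals a i j
ext-compare a zero (suc j) _ (s≤s j≤) = ext-compare₀ a j j≤
ext-compare [] (suc i) (suc zero) (s≤s ()) _
ext-compare [] (suc i) (suc (suc j)) _ (s≤s ())
ext-compare (x ∷ a) (suc i) (suc zero) (s≤s ()) _
ext-compare (true ∷ a) (suc zero) (suc (suc j)) _ (s≤s (s≤s j≤)) =
  proj₁ (ext-compare₀ a j j≤) , mk⇔ (λ _ → 1≤lo-true∷ a j) (λ _ → refl)
ext-compare (false ∷ a) (suc zero) (suc (suc j)) _ (s≤s (s≤s j≤)) =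
  let above , sep = ext-compare₀ a j j≤
  in above , ⇔-trans sep (⇔-sym (lo-∷ false a j (hi a 0) (1≤hi a 0)))
ext-compare (x ∷ a) (suc (suc i)) (suc (suc j)) (s≤s i<j) (s≤s j≤) with ext-compare a (suc i) (suc j) i<j j≤
... | above , sep rewrite ∧-inverseʳ x | hi-∷ x a i =
  above , ⇔-trans sep (⇔-sym (lo-∷ x a j (hi a (suc i)) (1≤hi a (suc i))))

toℕ≤ : ∀ {n} (i : Fin (n + 2)) → toℕ i ≤ suc n
toℕ≤ {n} i = ≤-pred (subst (toℕ i <_) (+-comm n 2) (toℕ<n i))

𝒫-interval : ∀ a (i j : Fin (length a + 2)) → _≼_ (𝒫 a) i j ⇔ (i ≡ j ⊎ hi a (toℕ i) ≤ lo a (toℕ j))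
𝒫-interval a i j = mk⇔ interval⇒ ⇒interval
  where
  interval⇒ : _≼_ (𝒫 a) i j → i ≡ j ⊎ hi a (toℕ i) ≤ lo a (toℕ j)
  interval⇒ (inj₁ i≡j) = inj₁ i≡j
  interval⇒ (inj₂ (i<j , opp)) =
    inj₂ (to (proj₂ (ext-compare a _ _ i<j (toℕ≤ j))) (proj₂ (to (Opposed⇔ _ _) opp)))
  ⇒interval : i ≡ j ⊎ hi a (toℕ i) ≤ lo a (toℕ j) → _≼_ (𝒫 a) i j
  ⇒interval (inj₁ i≡j) = inj₁ i≡j
  ⇒interval (inj₂ hi≤lo) =
    let i<j = hi≤lo⇒< a _ _ hi≤lo
        above , sep = ext-compare a _ _ i<j (toℕ≤ j)
    in inj₂ (i<j , from (Opposed⇔ _ _) (above , from sep hi≤lo))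

index : ∀ {n} k → k ≤ suc n → Fin (n + 2)
index {n} k k≤ = fromℕ< (subst (k <_) (+-comm 2 n) (s≤s k≤))

toℕ-index : ∀ {n} k (k≤ : k ≤ suc n) → toℕ (index k k≤) ≡ k
toℕ-index {n} k k≤ = toℕ-fromℕ< (subst (k <_) (+-comm 2 n) (s≤s k≤))

index-toℕ : ∀ {n k} (x : Fin (n + 2)) (k≤ : k ≤ suc n) → toℕ x ≡ k → x ≡ index k k≤
index-toℕ x k≤ e = toℕ-injective (trans e (sym (toℕ-index _ k≤)))

𝒫-intervalOrder : ∀ a → IntervalOrder (𝒫 a)
𝒫-intervalOrder a = record
  { start = λ x → lo a (toℕ x)
  ; end = λ x → hi a (toℕ x)
  ; start<end = λ x → lo<hi a (toℕ x)
  ; ≼⇔ = 𝒫-interval a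
  }

lastZero : List Bool → ℕ
lastZero a = prev false a (suc (length a))

lastZero≤ : ∀ a → lastZero a ≤ length a
lastZero≤ a = prev≤length false a (suc (length a))

bit-lastZero : ∀ a → bit a (lastZero a) ≡ false
bit-lastZero a = bit-prev-false a (suc (length a))

hi-lastZero : ∀ a → hi a (lastZero a) ≡ suc (length a)
hi-lastZero a rewrite bit-lastZero a =
  next-unique false a (lastZero a) (suc (length a)) (s≤s (lastZero≤ a)) (inj₂ refl)
    (λ w m<w w<n → bit-after-prev false a (suc (length a)) w m<w w<n (≤-pred w<n))

hi>length : ∀ a t → t ≤ suc (length a) → length a < hi a t → t ≡ lastZero a ⊎ t ≡ suc (length a)
hi>length a t t≤ n<hi with bit a t in e
... | true = inj₂ (≤-antisym t≤ n<hi)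
... | false =
  inj₁ (sym (trans (cong (prev false a) (sym next≡)) (prev-next false a t (bit≡false⇒≤length a t e) (inj₂ e))))
  where
  next≡ : next false a t ≡ suc (length a)
  next≡ = ≤-antisym (next≤ false a t) n<hi

firstOne : List Bool → ℕ
firstOne w = next true w 0

lo-firstOne : ∀ w → lo w (firstOne w) ≡ 0
lo-firstOne w rewrite bit-next-beyond w 0 = prev-next true w 0 z≤n (inj₁ refl)

lo≡0 : ∀ w k → k ≤ suc (length w) → lo w k ≡ 0 → k ≡ 0 ⊎ k ≡ firstOne w
lo≡0 w k k≤ lo≡ with bit w k in e
... | false = inj₁ lo≡
... | true = inj₂ (sym (trans (cong (next true w) (sym lo≡))
                     (next-prev true w k (bit≡true⇒1≤ w k e) (NextCandidate-true w k k≤ e))))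

module TopOf (a : List Bool) (1≤r : 1 ≤ length a) where
  r m : ℕ
  r = length a
  m = lastZero a

  m≤ : m ≤ suc r
  m≤ = m≤n⇒m≤1+n (lastZero≤ a)

  pm pr : Fin (r + 2)
  pm = index m m≤
  pr = index (suc r) ≤-refl

  p₀ p₁ : Fin (r + 2)
  p₀ = if bit a r then pr else pm
  p₁ = if bit a r then pm else pr

  pm≢pr : pm ≢ pr
  pm≢pr e = <⇒≢ (s≤s (lastZero≤ a)) (trans (sym (toℕ-index m m≤)) (trans (cong toℕ e) (toℕ-index (suc r) ≤-refl)))

  end≤ : ∀ x → x ≢ pm → x ≢ pr → hi a (toℕ x) ≤ r
  end≤ x x≢pm x≢pr with hi a (toℕ x) ≤? r
  ... | yes hi≤ = hi≤
  ... | no hi≰ with hi>length a (toℕ x) (toℕ≤ x) (≰⇒> hi≰)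
  ...   | inj₁ e = ⊥-elim (x≢pm (index-toℕ x m≤ e))
  ...   | inj₂ e = ⊥-elim (x≢pr (index-toℕ x ≤-refl e))

  <end-pm : r < hi a (toℕ pm)
  <end-pm rewrite toℕ-index m m≤ | hi-lastZero a = ≤-refl

  <end-pr : r < hi a (toℕ pr)
  <end-pr rewrite toℕ-index (suc r) ≤-refl | bit-beyond a (suc r) ≤-refl = ≤-refl

  prev-at : ∀ c → bit a r ≡ c → prev c a (suc r) ≡ r
  prev-at c e = prev-unique c a (suc r) r ≤-refl (inj₁ (1≤r , ≤-refl , e))
                  (λ w r<w w<1+r _ → ⊥-elim (<-irrefl refl (≤-trans w<1+r r<w)))

  shape-ending-0 : bit a r ≡ false → TopShape (𝒫-intervalOrder a) r pm pr
  shape-ending-0 e = record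
    { p₀≢p₁ = pm≢pr ; start≤ = λ x → lo≤length a (toℕ x) ; end≤ = end≤
    ; <end₀ = <end-pm ; <end₁ = <end-pr ; start₀ = start-pm
    ; witness = index y y≤ ; end-witness≤ = ≤-reflexive end-y ; witness⋠p₁ = y⋠pr
    }
    where
    start-pm : lo a (toℕ pm) ≡ r
    start-pm rewrite toℕ-index m m≤ | prev-at false e | e = refl
    y : ℕ
    y = prev false a r
    y≤ : y ≤ suc r
    y≤ = m≤n⇒m≤1+n (prev≤length false a r)
    y<r : y < r
    y<r = prev< false a r 1≤r
    end-y : hi a (toℕ (index y y≤)) ≡ r
    end-y rewrite toℕ-index y y≤ | bit-prev-false a r =
      next-unique false a y r y<r (inj₁ (≤-refl , e)) (λ w y<w w<r → bit-after-prev false a r w y<w w<r (<⇒≤ w<r))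
    y⋠pr : ¬ _≼_ (𝒫 a) (index y y≤) pr
    y⋠pr y≼pr with to (𝒫-interval a _ _) y≼pr
    ... | inj₁ y≡pr = <⇒≢ (<-trans y<r (n<1+n r))
                        (trans (sym (toℕ-index y y≤)) (trans (cong toℕ y≡pr) (toℕ-index (suc r) ≤-refl)))
    ... | inj₂ hi≤lo = true≢false (trans (sym (bit-prev true a (suc r) (subst (1 ≤_) (sym prev≡r) 1≤r)))
                                         (trans (cong (bit a) prev≡r) e))
      where
      lo-pr : lo a (toℕ pr) ≡ prev true a (suc r)
      lo-pr rewrite toℕ-index (suc r) ≤-refl | bit-beyond a (suc r) ≤-refl = refl
      prev≡r : prev true a (suc r) ≡ r
      prev≡r = ≤-antisym (prev-suc≤ true a r) (subst₂ _≤_ end-y lo-pr hi≤lo)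

  shape-ending-1 : bit a r ≡ true → TopShape (𝒫-intervalOrder a) r pr pm
  shape-ending-1 e = record
    { p₀≢p₁ = pm≢pr ∘ sym ; start≤ = λ x → lo≤length a (toℕ x)
    ; end≤ = λ x x≢pr x≢pm → end≤ x x≢pm x≢pr
    ; <end₀ = <end-pr ; <end₁ = <end-pm ; start₀ = start-pr
    ; witness = index r (n≤1+n r) ; end-witness≤ = ≤-reflexive end-r ; witness⋠p₁ = r⋠pm
    }
    where
    start-pr : lo a (toℕ pr) ≡ r
    start-pr rewrite toℕ-index (suc r) ≤-refl | bit-beyond a (suc r) ≤-refl = prev-at true e
    end-r : hi a (toℕ (index r (n≤1+n r))) ≡ r
    end-r rewrite toℕ-index r (n≤1+n r) | e = refl
    m≢r : m ≢ r
    m≢r m≡r = true≢false (trans (sym e) (trans (cong (bit a) (sym m≡r)) (bit-lastZero a)))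
    r⋠pm : ¬ _≼_ (𝒫 a) (index r (n≤1+n r)) pm
    r⋠pm r≼pm with to (𝒫-interval a _ _) r≼pm
    ... | inj₁ r≡pm = m≢r (trans (sym (toℕ-index m m≤)) (trans (cong toℕ (sym r≡pm)) (toℕ-index r (n≤1+n r))))
    ... | inj₂ hi≤lo = m≢r (≤-antisym (lastZero≤ a) (subst₂ _≤_ end-r lo-pm hi≤lo))
      where
      lo-pm : lo a (toℕ pm) ≡ m
      lo-pm rewrite toℕ-index m m≤ | bit-lastZero a = refl

  shape : TopShape (𝒫-intervalOrder a) r p₀ p₁
  shape with bit a r in e
  ... | false = shape-ending-0 e
  ... | true = shape-ending-1 e

module BottomOf (w : List Bool) (1≤s : 1 ≤ length w) where
  s k : ℕ
  s = length w
  k = firstOne w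
  k≤ : k ≤ suc s
  k≤ = next≤ true w 0

  q0 qk : Fin (s + 2)
  q0 = index 0 z≤n
  qk = index k k≤

  q₀ q₁ : Fin (s + 2)
  q₀ = if bit w 1 then qk else q0
  q₁ = if bit w 1 then q0 else qk

  q0≢qk : q0 ≢ qk
  q0≢qk e = <⇒≢ (1≤next true w 0) (trans (sym (toℕ-index {s} 0 z≤n)) (trans (cong toℕ e) (toℕ-index k k≤)))

  lo-q0 : lo w (toℕ q0) ≡ 0
  lo-q0 rewrite toℕ-index {s} 0 z≤n = refl

  lo-qk : lo w (toℕ qk) ≡ 0
  lo-qk rewrite toℕ-index k k≤ = lo-firstOne w

  <start : ∀ x → x ≢ q0 → x ≢ qk → 0 < lo w (toℕ x)
  <start x x≢q0 x≢qk with lo w (toℕ x) in e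
  ... | suc _ = s≤s z≤n
  ... | zero with lo≡0 w (toℕ x) (toℕ≤ x) e
  ...   | inj₁ x≡0 = ⊥-elim (x≢q0 (index-toℕ {s} x z≤n x≡0))
  ...   | inj₂ x≡k = ⊥-elim (x≢qk (index-toℕ x k≤ x≡k))

  shape-starting-0 : bit w 1 ≡ false → BottomShape (𝒫-intervalOrder w) 0 q0 qk
  shape-starting-0 e = record
    { q₀≢q₁ = q0≢qk ; <end = λ x → 1≤hi w (toℕ x) ; <start = <start
    ; start₀≤ = ≤-reflexive lo-q0 ; start₁≤ = ≤-reflexive lo-qk ; end₀ = end-q0
    ; witness = index {s} 1 (s≤s z≤n) ; <start-witness = ≤-reflexive (sym start-1) ; q₁⋠witness = qk⋠1
    }
    where
    end-q0 : hi w (toℕ q0) ≡ 1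
    end-q0 rewrite toℕ-index {s} 0 z≤n =
      next-unique false w 0 1 (s≤s z≤n) (inj₁ (1≤s , e)) (λ _ 0<v v<1 → ⊥-elim (<⇒≱ 0<v (≤-pred v<1)))
    start-1 : lo w (toℕ (index {s} 1 (s≤s z≤n))) ≡ 1
    start-1 rewrite toℕ-index {s} 1 (s≤s z≤n) | e = refl
    k≢1 : k ≢ 1
    k≢1 k≡1 = true≢false (trans (sym (bit-next-beyond w 0)) (trans (cong (bit w) k≡1) e))
    qk⋠1 : ¬ _≼_ (𝒫 w) qk (index {s} 1 (s≤s z≤n))
    qk⋠1 qk≼1 with to (𝒫-interval w _ _) qk≼1
    ... | inj₁ qk≡1 = k≢1 (trans (sym (toℕ-index k k≤)) (trans (cong toℕ qk≡1) (toℕ-index {s} 1 (s≤s z≤n))))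
    ... | inj₂ hi≤lo = k≢1 (≤-antisym (subst₂ _≤_ end-qk start-1 hi≤lo) (1≤next true w 0))
      where
      end-qk : hi w (toℕ qk) ≡ k
      end-qk rewrite toℕ-index k k≤ | bit-next-beyond w 0 = refl

  shape-starting-1 : bit w 1 ≡ true → BottomShape (𝒫-intervalOrder w) 0 qk q0
  shape-starting-1 e = record
    { q₀≢q₁ = q0≢qk ∘ sym ; <end = λ x → 1≤hi w (toℕ x) ; <start = λ x x≢qk x≢q0 → <start x x≢q0 x≢qk
    ; start₀≤ = ≤-reflexive lo-qk ; start₁≤ = ≤-reflexive lo-q0 ; end₀ = end-qk
    ; witness = index y y≤ ; <start-witness = ≤-reflexive (sym start-y) ; q₁⋠witness = q0⋠y
    }
    where
    k≡1 : k ≡ 1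
    k≡1 = next-unique true w 0 1 (s≤s z≤n) (inj₁ (1≤s , e)) (λ _ 0<v v<1 → ⊥-elim (<⇒≱ 0<v (≤-pred v<1)))
    end-qk : hi w (toℕ qk) ≡ 1
    end-qk rewrite toℕ-index k k≤ | k≡1 | e = refl
    y : ℕ
    y = next true w 1
    y≤ : y ≤ suc s
    y≤ = next≤ true w 1
    start-y : lo w (toℕ (index y y≤)) ≡ 1
    start-y rewrite toℕ-index y y≤ | bit-next-beyond w 1 = prev-next true w 1 1≤s (inj₂ e)
    q0⋠y : ¬ _≼_ (𝒫 w) q0 (index y y≤)
    q0⋠y q0≼y with to (𝒫-interval w _ _) q0≼y
    ... | inj₁ q0≡y = <⇒≢ (<-trans (s≤s z≤n) (<next true w 1 1≤s))
                        (trans (sym (toℕ-index {s} 0 z≤n)) (trans (cong toℕ q0≡y) (toℕ-index y y≤)))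
    ... | inj₂ hi≤lo = true≢false (trans (sym e)
                         (trans (cong (bit w) (sym next≡1)) (bit-next false w 0 (≤-trans (≤-reflexive next≡1) 1≤s))))
      where
      end-q0 : hi w (toℕ q0) ≡ next false w 0
      end-q0 rewrite toℕ-index {s} 0 z≤n = refl
      next≡1 : next false w 0 ≡ 1
      next≡1 = ≤-antisym (subst₂ _≤_ end-q0 start-y hi≤lo) (1≤next false w 0)

  shape : BottomShape (𝒫-intervalOrder w) 0 q₀ q₁
  shape with bit w 1 in e
  ... | false = shape-starting-0 e
  ... | true = shape-starting-1 e

-- Concatenation

bit-++ˡ : ∀ a w t → t ≤ length a → bit (a ++ w) t ≡ bit a t
bit-++ˡ a w zero _ = refl
bit-++ˡ (x ∷ a) w (suc zero) _ = refl
bit-++ˡ (x ∷ a) w (suc (suc t)) (s≤s t≤) = bit-++ˡ a w (suc t) t≤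

bit-++ʳ : ∀ a w k → 1 ≤ k → bit (a ++ w) (length a + k) ≡ bit w k
bit-++ʳ [] w k _ = refl
bit-++ʳ (x ∷ a) w k 1≤k =
  trans (bit-∷ x (a ++ w) (length a + k) (≤-trans 1≤k (m≤n+m k (length a)))) (bit-++ʳ a w k 1≤k)

next-++ʳ : ∀ c a w k → next c (a ++ w) (length a + k) ≡ length a + next c w k
next-++ʳ c [] w k = refl
next-++ʳ c (x ∷ a) w k = cong suc (next-++ʳ c a w k)

next-++ˡ : ∀ c a w t → t ≤ length a →
           (next c a t ≤ length a × next c (a ++ w) t ≡ next c a t) ⊎
           (next c a t ≡ suc (length a) × next c (a ++ w) t ≡ length a + next c w 0)
next-++ˡ c [] w zero _ = inj₂ (refl , refl)
next-++ˡ c (x ∷ a) w zero _ with x ≟ᵇ c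
... | yes _ = inj₁ (s≤s z≤n , refl)
... | no _ with next-++ˡ c a w 0 z≤n
...   | inj₁ (n≤ , e) = inj₁ (s≤s n≤ , cong suc e)
...   | inj₂ (n≡ , e) = inj₂ (cong suc n≡ , cong suc e)
next-++ˡ c (x ∷ a) w (suc t) (s≤s t≤) with next-++ˡ c a w t t≤
... | inj₁ (n≤ , e) = inj₁ (s≤s n≤ , cong suc e)
... | inj₂ (n≡ , e) = inj₂ (cong suc n≡ , cong suc e)

prev-++ˡ : ∀ c a w t → t ≤ suc (length a) → prev c (a ++ w) t ≡ prev c a t
prev-++ˡ c a w zero _ = refl
prev-++ˡ c a w (suc zero) _ = refl
prev-++ˡ c [] w (suc (suc t)) (s≤s ())
prev-++ˡ c (x ∷ a) w (suc (suc t)) (s≤s t≤) = cong (prevStep x c) (prev-++ˡ c a w (suc t) t≤)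

prev-++ʳ : ∀ c a w k → 1 ≤ k →
           (1 ≤ prev c w k × prev c (a ++ w) (length a + k) ≡ length a + prev c w k) ⊎
           (prev c w k ≡ 0 × prev c (a ++ w) (length a + k) ≡ prev c a (suc (length a)))
prev-++ʳ c [] w k _ with prev c w k
... | zero = inj₂ (refl , refl)
... | suc p = inj₁ (s≤s z≤n , refl)
prev-++ʳ c (x ∷ a) w k 1≤k = step (length a + k) refl (prev-++ʳ c a w k 1≤k)
  where
  step : ∀ t → t ≡ length a + k →
         (1 ≤ prev c w k × prev c (a ++ w) t ≡ length a + prev c w k) ⊎
         (prev c w k ≡ 0 × prev c (a ++ w) t ≡ prev c a (suc (length a))) →
         (1 ≤ prev c w k × prev c (x ∷ a ++ w) (suc t) ≡ suc (length a) + prev c w k) ⊎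
         (prev c w k ≡ 0 × prev c (x ∷ a ++ w) (suc t) ≡ prev c (x ∷ a) (suc (suc (length a))))
  step zero e _ = ⊥-elim (<-irrefl refl (≤-trans (≤-trans 1≤k (m≤n+m k (length a))) (≤-reflexive (sym e))))
  step (suc t) _ (inj₁ (1≤p , e)) =
    inj₁ (1≤p , trans (cong (prevStep x c) e) (step-suc (≤-trans 1≤p (m≤n+m _ (length a)))))
    where
    step-suc : ∀ {p} → 1 ≤ p → prevStep x c p ≡ suc p
    step-suc {suc p} _ = refl
  step (suc t) _ (inj₂ (p≡0 , e)) = inj₂ (p≡0 , cong (prevStep x c) e)

-- The picture of w is shifted by r and laid next to that of a: a(i) ↦ c(i) for i ≤ r and
-- w(j) ↦ c(r + j) for j ≥ 1, while a(r+1) and w(k) (k the first 1 of w) both become c(r + k),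
-- and a(m) and w(0) (m the last 0 of a) both become c(m).
module Concatenation (a w : List Bool) (1≤r : 1 ≤ length a) (1≤s : 1 ≤ length w) where
  r s m k : ℕ
  r = length a
  s = length w
  m = lastZero a
  k = firstOne w

  c : List Bool
  c = a ++ w

  1≤k : 1 ≤ k
  1≤k = 1≤next true w 0

  m≤r : m ≤ r
  m≤r = lastZero≤ a

  below-c : ∀ {z} → z ≤ suc (r + s) → z ≤ suc (length c)
  below-c {z} = subst (λ n → z ≤ suc n) (sym (length-++ a))

  r+≤ : ∀ {j} → j ≤ suc s → r + j ≤ suc (r + s)
  r+≤ j≤ = ≤-trans (+-monoʳ-≤ r j≤) (≤-reflexive (+-suc r s))

  F₁ : ℕ → ℕ
  F₁ i = if i ≤ᵇ r then i else r + k

  G₂ : ℕ → ℕ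
  G₂ zero = m
  G₂ (suc j) = r + suc j

  F₁-suc-r : F₁ (suc r) ≡ r + k
  F₁-suc-r with suc r ≤ᵇ r in e
  ... | true = ⊥-elim (<-irrefl refl (≤ᵇ⇒≤ (suc r) r (subst T (sym e) tt)))
  ... | false = refl

  F₁-≤r : ∀ {i} → i ≤ r → F₁ i ≡ i
  F₁-≤r {i} i≤r with i ≤ᵇ r in e
  ... | true = refl
  ... | false = ⊥-elim (subst T e (≤⇒≤ᵇ i≤r))

  G₂-suc : ∀ {j} → 1 ≤ j → G₂ j ≡ r + j
  G₂-suc {suc j} _ = refl

  ≤r-or-suc-r : ∀ {i} → i ≤ suc r → i ≤ r ⊎ i ≡ suc r
  ≤r-or-suc-r i≤ with m≤n⇒m<n∨m≡n i≤
  ... | inj₁ i<1+r = inj₁ (≤-pred i<1+r)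
  ... | inj₂ i≡1+r = inj₂ i≡1+r

  F₁≤ : ∀ i → i ≤ suc r → F₁ i ≤ suc (length c)
  F₁≤ i i≤ with ≤r-or-suc-r i≤
  ... | inj₁ i≤r rewrite F₁-≤r i≤r = below-c (≤-trans i≤r (≤-trans (m≤m+n r s) (n≤1+n _)))
  ... | inj₂ refl rewrite F₁-suc-r = below-c (r+≤ (next≤ true w 0))

  G₂≤ : ∀ j → j ≤ suc s → G₂ j ≤ suc (length c)
  G₂≤ zero _ = below-c (≤-trans m≤r (≤-trans (m≤m+n r s) (n≤1+n _)))
  G₂≤ (suc j) j≤ = below-c (r+≤ j≤)

  f₁ : Fin (r + 2) → Fin (length c + 2)
  f₁ x = index (F₁ (toℕ x)) (F₁≤ _ (toℕ≤ x))

  f₂ : Fin (s + 2) → Fin (length c + 2)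
  f₂ y = index (G₂ (toℕ y)) (G₂≤ _ (toℕ≤ y))

  toℕ-f₁ : ∀ x → toℕ (f₁ x) ≡ F₁ (toℕ x)
  toℕ-f₁ x = toℕ-index _ (F₁≤ _ (toℕ≤ x))

  toℕ-f₂ : ∀ y → toℕ (f₂ y) ≡ G₂ (toℕ y)
  toℕ-f₂ y = toℕ-index _ (G₂≤ _ (toℕ≤ y))

  lo-c : ∀ t → t ≤ r → lo c t ≡ lo a t
  lo-c t t≤ rewrite bit-++ˡ a w t t≤ | prev-++ˡ true a w t (m≤n⇒m≤1+n t≤) = refl

  start-F₁ : ∀ i → i ≤ suc r → lo c (F₁ i) ≡ lo a i
  start-F₁ i i≤ with ≤r-or-suc-r i≤
  ... | inj₁ i≤r rewrite F₁-≤r i≤r = lo-c i i≤r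
  ... | inj₂ refl rewrite F₁-suc-r | bit-++ʳ a w k 1≤k | bit-next-beyond w 0 | bit-beyond a (suc r) ≤-refl
    with prev-++ʳ true a w k 1≤k
  ...   | inj₁ (1≤p , _) = ⊥-elim (<⇒≱ 1≤p (≤-reflexive (prev-next true w 0 z≤n (inj₁ refl))))
  ...   | inj₂ (_ , e) = e

  end-F₁ : ∀ i → i ≤ suc r → hi a i ≤ r → hi c (F₁ i) ≡ hi a i
  end-F₁ i i≤ hi≤r with ≤r-or-suc-r i≤
  ... | inj₂ refl rewrite bit-beyond a (suc r) ≤-refl = ⊥-elim (<-irrefl refl hi≤r)
  ... | inj₁ i≤r rewrite F₁-≤r i≤r | bit-++ˡ a w i i≤r with bit a i
  ...   | true = refl
  ...   | false with next-++ˡ false a w i i≤r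
  ...     | inj₁ (_ , e) = e
  ...     | inj₂ (n≡ , _) = ⊥-elim (<-irrefl refl (subst (_≤ r) n≡ hi≤r))

  end-G₂ : ∀ j → hi c (G₂ j) ≡ r + hi w j
  end-G₂ zero rewrite bit-++ˡ a w m m≤r | bit-lastZero a with next-++ˡ false a w m m≤r
  ... | inj₂ (_ , e) = e
  ... | inj₁ (n≤ , _) = ⊥-elim (<-irrefl refl (subst (_≤ r) next≡ n≤))
    where
    next≡ : next false a m ≡ suc r
    next≡ = trans (sym (cong (λ β → if β then m else next false a m) (bit-lastZero a))) (hi-lastZero a)
  end-G₂ (suc j) rewrite bit-++ʳ a w (suc j) (s≤s z≤n) with bit w (suc j)
  ... | true = refl
  ... | false = next-++ʳ false a w (suc j)

  start-G₂ : ∀ j → 1 ≤ lo w j → lo c (G₂ j) ≡ r + lo w j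
  start-G₂ (suc j) 1≤lo rewrite bit-++ʳ a w (suc j) (s≤s z≤n) with bit w (suc j)
  ... | false = refl
  ... | true with prev-++ʳ true a w (suc j) (s≤s z≤n)
  ...   | inj₁ (_ , e) = e
  ...   | inj₂ (p≡0 , _) = ⊥-elim (<⇒≱ 1≤lo (≤-reflexive p≡0))

  F₁-injective : ∀ i i′ → i ≤ suc r → i′ ≤ suc r → F₁ i ≡ F₁ i′ → i ≡ i′
  F₁-injective i i′ i≤ i′≤ e with ≤r-or-suc-r i≤ | ≤r-or-suc-r i′≤
  ... | inj₁ i≤r | inj₁ i′≤r = trans (sym (F₁-≤r i≤r)) (trans e (F₁-≤r i′≤r))
  ... | inj₁ i≤r | inj₂ refl =
    ⊥-elim (<⇒≱ (m<m+n r 1≤k) (subst (_≤ r) (trans (sym (F₁-≤r i≤r)) (trans e F₁-suc-r)) i≤r))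
  ... | inj₂ refl | inj₁ i′≤r =
    ⊥-elim (<⇒≱ (m<m+n r 1≤k) (subst (_≤ r) (trans (sym (F₁-≤r i′≤r)) (trans (sym e) F₁-suc-r)) i′≤r))
  ... | inj₂ refl | inj₂ refl = refl

  G₂-injective : ∀ j j′ → G₂ j ≡ G₂ j′ → j ≡ j′
  G₂-injective zero zero _ = refl
  G₂-injective zero (suc j′) e = ⊥-elim (<⇒≱ (m<m+n r (s≤s z≤n)) (subst (_≤ r) e m≤r))
  G₂-injective (suc j) zero e = ⊥-elim (<⇒≱ (m<m+n r (s≤s z≤n)) (subst (_≤ r) (sym e) m≤r))
  G₂-injective (suc j) (suc j′) e = +-cancelˡ-≡ r _ _ e

  f₁-injective : ∀ x x′ → f₁ x ≡ f₁ x′ → x ≡ x′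
  f₁-injective x x′ e = toℕ-injective (F₁-injective _ _ (toℕ≤ x) (toℕ≤ x′)
    (trans (sym (toℕ-f₁ x)) (trans (cong toℕ e) (toℕ-f₁ x′))))

  f₂-injective : ∀ y y′ → f₂ y ≡ f₂ y′ → y ≡ y′
  f₂-injective y y′ e = toℕ-injective (G₂-injective _ _ (trans (sym (toℕ-f₂ y)) (trans (cong toℕ e) (toℕ-f₂ y′))))

  f-covers : ∀ z → (Σ[ x ∈ _ ] f₁ x ≡ z) ⊎ (Σ[ y ∈ _ ] f₂ y ≡ z)
  f-covers z with toℕ z ≤? r
  ... | yes z≤r = inj₁ (x , toℕ-injective (trans (toℕ-f₁ x) (trans (cong F₁ toℕ-x) (F₁-≤r z≤r))))
    where
    x : Fin (r + 2)
    x = index (toℕ z) (m≤n⇒m≤1+n z≤r)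
    toℕ-x : toℕ x ≡ toℕ z
    toℕ-x = toℕ-index _ (m≤n⇒m≤1+n z≤r)
  ... | no z≰r =
    inj₂ (y , toℕ-injective (trans (toℕ-f₂ y) (trans (cong G₂ (toℕ-index j j≤)) (trans (G₂-suc 1≤j) r+j≡z))))
    where
    j : ℕ
    j = toℕ z ∸ r
    r+j≡z : r + j ≡ toℕ z
    r+j≡z = m+[n∸m]≡n (<⇒≤ (≰⇒> z≰r))
    1≤j : 1 ≤ j
    1≤j with j | r+j≡z
    ... | zero | r+0≡z = ⊥-elim (z≰r (≤-reflexive (trans (sym r+0≡z) (+-identityʳ r))))
    ... | suc _ | _ = s≤s z≤n
    j≤ : j ≤ suc s
    j≤ = +-cancelˡ-≤ r j (suc s) (subst₂ _≤_ (sym r+j≡z) (sym (+-suc r s))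
           (subst (λ n → toℕ z ≤ suc n) (length-++ a) (toℕ≤ z)))
    y : Fin (s + 2)
    y = index j j≤

  open TopOf a 1≤r using (pm; pr; m≤)
  open BottomOf w 1≤s using (q0; qk; k≤)

  glue-m : f₁ pm ≡ f₂ q0
  glue-m = toℕ-injective (begin
    toℕ (f₁ pm)   ≡⟨ toℕ-f₁ pm ⟩
    F₁ (toℕ pm)   ≡⟨ cong F₁ (toℕ-index m m≤) ⟩
    F₁ m          ≡⟨ F₁-≤r m≤r ⟩
    G₂ 0          ≡⟨ cong G₂ (toℕ-index {s} 0 z≤n) ⟨
    G₂ (toℕ q0)   ≡⟨ toℕ-f₂ q0 ⟨
    toℕ (f₂ q0)   ∎)
    where open ≡-Reasoning

  glue-r : f₁ pr ≡ f₂ qk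
  glue-r = toℕ-injective (begin
    toℕ (f₁ pr)   ≡⟨ toℕ-f₁ pr ⟩
    F₁ (toℕ pr)   ≡⟨ cong F₁ (toℕ-index (suc r) ≤-refl) ⟩
    F₁ (suc r)    ≡⟨ F₁-suc-r ⟩
    r + k         ≡⟨ G₂-suc 1≤k ⟨
    G₂ k          ≡⟨ cong G₂ (toℕ-index k k≤) ⟨
    G₂ (toℕ qk)   ≡⟨ toℕ-f₂ qk ⟨
    toℕ (f₂ qk)   ∎)
    where open ≡-Reasoning

  r<r+l⇒1≤l : ∀ {l} → r < r + l → 1 ≤ l
  r<r+l⇒1≤l {zero} r<r+0 = ⊥-elim (<-irrefl (sym (+-identityʳ r)) r<r+0)
  r<r+l⇒1≤l {suc l} _ = s≤s z≤n

  module _ (aᵣ≡w₁ : bit a r ≡ bit w 1) where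
    open TopOf a 1≤r using (p₀; p₁) renaming (shape to top)
    open BottomOf w 1≤s using (q₀; q₁) renaming (shape to bottom)

    glue₀ : f₁ p₀ ≡ f₂ q₀
    glue₀ rewrite aᵣ≡w₁ with bit w 1
    ... | true = glue-r
    ... | false = glue-m

    glue₁ : f₁ p₁ ≡ f₂ q₁
    glue₁ rewrite aᵣ≡w₁ with bit w 1
    ... | true = glue-m
    ... | false = glue-r

    spliceIso : SpliceIso (𝒫 a) (𝒫 w) (𝒫 c)
    spliceIso = SpliceIso-intro {R = 𝒫 c}
      (TopShape⇒SpliceLeft (𝒫-intervalOrder a) top) (BottomShape⇒SpliceRight (𝒫-intervalOrder w) bottom)
      (SpliceOfIntervalOrders.isoTo (𝒫-intervalOrder a) (shift r (𝒫-intervalOrder w)) (𝒫-intervalOrder c)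
        top (subst (λ N → BottomShape (shift r (𝒫-intervalOrder w)) N q₀ q₁) (+-identityʳ r) (BottomShape-shift r bottom))
        f₁ f₂ f₁-injective f₂-injective f-covers glue₀ glue₁
        (λ x → trans (cong (lo c) (toℕ-f₁ x)) (start-F₁ (toℕ x) (toℕ≤ x)))
        (λ x hi≤r → trans (cong (hi c) (toℕ-f₁ x)) (end-F₁ (toℕ x) (toℕ≤ x) hi≤r))
        (λ y → trans (cong (hi c) (toℕ-f₂ y)) (end-G₂ (toℕ y)))
        (λ y r<r+lo → trans (cong (lo c) (toℕ-f₂ y)) (start-G₂ (toℕ y) (r<r+l⇒1≤l r<r+lo))))

splice-++ : ∀ a w → 1 ≤ length a → 1 ≤ length w → bit a (length a) ≡ bit w 1 →
            SpliceIso (𝒫 a) (𝒫 w) (𝒫 (a ++ w))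
splice-++ = Concatenation.spliceIso

-- Complementation

compl-length : ∀ b → length (compl b) ≡ length b
compl-length = length-map not

compl-involutive : ∀ b → compl (compl b) ≡ b
compl-involutive [] = refl
compl-involutive (x ∷ b) = cong₂ _∷_ (not-involutive x) (compl-involutive b)

bit-compl : ∀ b t → 1 ≤ t → t ≤ length b → bit (compl b) t ≡ not (bit b t)
bit-compl (x ∷ b) (suc zero) _ _ = refl
bit-compl (x ∷ b) (suc (suc t)) _ (s≤s t≤) = bit-compl b (suc t) (s≤s z≤n) t≤

≟-not : ∀ x c → does (not x ≟ᵇ c) ≡ does (x ≟ᵇ not c)
≟-not true true = refl
≟-not true false = refl
≟-not false true = refl
≟-not false false = refl

next-compl : ∀ c b t → next c (compl b) t ≡ next (not c) b t
next-compl c [] t = refl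
next-compl c (x ∷ b) zero rewrite ≟-not x c | next-compl c b 0 = refl
next-compl c (x ∷ b) (suc t) = cong suc (next-compl c b t)

prev-compl : ∀ c b t → prev c (compl b) t ≡ prev (not c) b t
prev-compl c b zero = refl
prev-compl c b (suc zero) = refl
prev-compl c [] (suc (suc t)) = refl
prev-compl c (x ∷ b) (suc (suc t)) rewrite prev-compl c b (suc t) with prev (not c) b (suc t)
... | zero rewrite ≟-not x c = refl
... | suc p = refl

-- Complementing exchanges 0s and 1s, so the interval of a 0 at t, running forward to the
-- next 0, becomes in b̄ the interval of the 1 at its right end, and dually for a 1.
mirror : List Bool → ℕ → ℕ
mirror b t = if bit b t then prev true b t else next false b t

mirror≤ : ∀ b t → mirror b t ≤ suc (length b)
mirror≤ b t with bit b t
... | true = m≤n⇒m≤1+n (prev≤length true b t)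
... | false = next≤ false b t

compl-at-next0 : ∀ b t → bit b t ≡ false →
                 bit (compl b) (next false b t) ≡ true × prev true (compl b) (next false b t) ≡ t
compl-at-next0 b t e = bit-z , trans (prev-compl true b z) (prev-next false b t (bit≡false⇒≤length b t e) (inj₂ e))
  where
  z : ℕ
  z = next false b t
  bit-z : bit (compl b) z ≡ true
  bit-z with z ≤? length b
  ... | yes z≤length = trans (bit-compl b z (1≤next false b t) z≤length) (cong not (bit-next false b t z≤length))
  ... | no z≰n = bit-beyond (compl b) z (subst (_< z) (sym (compl-length b)) (≰⇒> z≰n))

compl-at-prev1 : ∀ b t → t ≤ suc (length b) → bit b t ≡ true →
                 bit (compl b) (prev true b t) ≡ false × next false (compl b) (prev true b t) ≡ t
compl-at-prev1 b t t≤ e =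
  bit-o , trans (next-compl false b o) (next-prev true b t (bit≡true⇒1≤ b t e) (NextCandidate-true b t t≤ e))
  where
  o : ℕ
  o = prev true b t
  bit-o : bit (compl b) o ≡ false
  bit-o with o in eo
  ... | zero = refl
  ... | suc p = trans (bit-compl b (suc p) (s≤s z≤n) (subst (_≤ length b) eo (prev≤length true b t)))
                      (cong not (trans (cong (bit b) (sym eo)) (bit-prev true b t (subst (1 ≤_) (sym eo) (s≤s z≤n)))))

mirror-interval : ∀ b t → t ≤ suc (length b) →
  mirror (compl b) (mirror b t) ≡ t × lo (compl b) (mirror b t) ≡ lo b t × hi (compl b) (mirror b t) ≡ hi b t
mirror-interval b t t≤ with bit b t in e
... | false with compl-at-next0 b t e
...   | bit-z , prev-z rewrite bit-z = prev-z , prev-z , refl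
mirror-interval b t t≤ | true with compl-at-prev1 b t t≤ e
...   | bit-o , next-o rewrite bit-o = next-o , refl , next-o

𝒫-compl : ∀ b → 𝒫 b ≅ 𝒫 (compl b)
𝒫-compl b = record { fun = fun ; inv = inv ; inv∘fun = inv∘fun ; fun∘inv = fun∘inv ; ≼⇔ = ≼⇔ }
  where
  w : List Bool
  w = compl b
  fun-bound : ∀ t → mirror b t ≤ suc (length w)
  fun-bound t = subst (λ n → mirror b t ≤ suc n) (sym (compl-length b)) (mirror≤ b t)
  inv-bound : ∀ t → mirror w t ≤ suc (length b)
  inv-bound t = subst (λ n → mirror w t ≤ suc n) (compl-length b) (mirror≤ w t)
  fun : Fin (length b + 2) → Fin (length w + 2)
  fun x = index (mirror b (toℕ x)) (fun-bound (toℕ x))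
  inv : Fin (length w + 2) → Fin (length b + 2)
  inv y = index (mirror w (toℕ y)) (inv-bound (toℕ y))
  toℕ-fun : ∀ x → toℕ (fun x) ≡ mirror b (toℕ x)
  toℕ-fun x = toℕ-index _ (fun-bound (toℕ x))
  toℕ-inv : ∀ y → toℕ (inv y) ≡ mirror w (toℕ y)
  toℕ-inv y = toℕ-index _ (inv-bound (toℕ y))
  inv∘fun : ∀ x → inv (fun x) ≡ x
  inv∘fun x = toℕ-injective (begin
    toℕ (inv (fun x))       ≡⟨ toℕ-inv (fun x) ⟩
    mirror w (toℕ (fun x))  ≡⟨ cong (mirror w) (toℕ-fun x) ⟩
    mirror w (mirror b (toℕ x)) ≡⟨ proj₁ (mirror-interval b (toℕ x) (toℕ≤ x)) ⟩
    toℕ x                   ∎)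
    where open ≡-Reasoning
  fun∘inv : ∀ y → fun (inv y) ≡ y
  fun∘inv y = toℕ-injective (begin
    toℕ (fun (inv y))       ≡⟨ toℕ-fun (inv y) ⟩
    mirror b (toℕ (inv y))  ≡⟨ cong (mirror b) (toℕ-inv y) ⟩
    mirror b (mirror w (toℕ y)) ≡⟨ cong (λ u → mirror u (mirror w (toℕ y))) (compl-involutive b) ⟨
    mirror (compl w) (mirror w (toℕ y)) ≡⟨ proj₁ (mirror-interval w (toℕ y) (toℕ≤ y)) ⟩
    toℕ y                   ∎)
    where open ≡-Reasoning
  hi-fun : ∀ x → hi w (toℕ (fun x)) ≡ hi b (toℕ x)
  hi-fun x = trans (cong (hi w) (toℕ-fun x)) (proj₂ (proj₂ (mirror-interval b (toℕ x) (toℕ≤ x))))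
  lo-fun : ∀ x → lo w (toℕ (fun x)) ≡ lo b (toℕ x)
  lo-fun x = trans (cong (lo w) (toℕ-fun x)) (proj₁ (proj₂ (mirror-interval b (toℕ x) (toℕ≤ x))))
  ≼⇔ : ∀ x y → _≼_ (𝒫 b) x y ⇔ _≼_ (𝒫 w) (fun x) (fun y)
  ≼⇔ x y = ⇔-trans (𝒫-interval b x y) (⇔-trans
    (mk⇔ (Sum.map (cong fun) (subst₂ _≤_ (sym (hi-fun x)) (sym (lo-fun y))))
         (Sum.map (λ e → trans (sym (inv∘fun x)) (trans (cong inv e) (inv∘fun y))) (subst₂ _≤_ (hi-fun x) (lo-fun y))))
    (⇔-sym (𝒫-interval w (fun x) (fun y))))

splice-compl : ∀ a b → 1 ≤ length a → 1 ≤ length b → bit a (length a) ≡ bit (compl b) 1 →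
               SpliceIso (𝒫 a) (𝒫 b) (𝒫 (a ++ compl b))
splice-compl a b 1≤r 1≤s aᵣ≡w₁ =
  SpliceIso-≅ {R = 𝒫 (a ++ compl b)} (𝒫-compl b)
    (splice-++ a (compl b) 1≤r (subst (1 ≤_) (sym (compl-length b)) 1≤s) aᵣ≡w₁)

bit-last : ∀ a₀ x → bit (a₀ ++ [ x ]) (length (a₀ ++ [ x ])) ≡ x
bit-last a₀ x rewrite length-++ a₀ {[ x ]} = bit-++ʳ a₀ [ x ] 1 (s≤s z≤n)

1≤length-∷ʳ : ∀ a₀ (x : Bool) → 1 ≤ length (a₀ ++ [ x ])
1≤length-∷ʳ a₀ x rewrite length-++ a₀ {[ x ]} = m≤n+m 1 (length a₀)

proposition5p3 : (a₀ : List Bool) (aᵣ b₁ : Bool) (b₀ : List Bool) →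
    -- a = a₀ aᵣ (length r ≥ 1), b = b₁ b₀ (length s ≥ 1)
    (Σ[ p₀ ∈ _ ] Σ[ p₁ ∈ _ ] SpliceLeft (𝒫 (a₀ ++ [ aᵣ ])) p₀ p₁)
    × (Σ[ q₀ ∈ _ ] Σ[ q₁ ∈ _ ] SpliceRight (𝒫 (b₁ ∷ b₀)) q₀ q₁)
    × (∀ p₀ p₁ q₀ q₁ →
         SpliceLeft (𝒫 (a₀ ++ [ aᵣ ])) p₀ p₁ →
         SpliceRight (𝒫 (b₁ ∷ b₀)) q₀ q₁ →
         Splice.IsoTo (𝒫 (a₀ ++ [ aᵣ ])) (𝒫 (b₁ ∷ b₀)) p₀ p₁ q₀ q₁
           (𝒫 (glue (a₀ ++ [ aᵣ ]) aᵣ b₁ (b₁ ∷ b₀))))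
proposition5p3 a₀ false false b₀ = splice-++ _ _ (1≤length-∷ʳ a₀ false) (s≤s z≤n) (bit-last a₀ false)
proposition5p3 a₀ true true b₀ = splice-++ _ _ (1≤length-∷ʳ a₀ true) (s≤s z≤n) (bit-last a₀ true)
proposition5p3 a₀ false true b₀ = splice-compl _ _ (1≤length-∷ʳ a₀ false) (s≤s z≤n) (bit-last a₀ false)
proposition5p3 a₀ true false b₀ = splice-compl _ _ (1≤length-∷ʳ a₀ true) (s≤s z≤n) (bit-last a₀ true)
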